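{- Let $\{\mu_T\}_{T\subseteq V,|T|\le m}$ be a consistent collection of local distributions over assignments $[k]^T$, with associated local random variables $X_1,\dots,X_n$. Let $S\subseteq V$ with $|S|=m-t$, and let $\mu^{|S}$ be the distribution over global assignments $x\in[k]^V$ output by propagation rounding with seed set $S$. Then for every $T\subseteq V$ with $|T|\le t$, $$\big\|\mu_T-\mu^{|S}_T\big\|\le\sum_{s\in T}\mathrm{Var}[X_s\mid X_S],$$ where $\mu^{|S}_T$ is the marginal of $\mu^{|S}$ on $T$ and $\|\cdot\|$ denotes statistical (total variation) distance.
   Context: Consistency: $\mu_T$ and $\mu_{T'}$ have the same marginal on $T\cap T'$. Propagation rounding with seed set $S$: sample $x_S\sim\mu_S$; then for each $i\in V\setminus S$ independently sample $x_i$ from $\mu_{S\cup\{i\}}$ conditioned on the assignment $x_S$. For a random variable $Y$ over $[k]$, $\mathrm{Var}\,Y=1-\Pr[Y=Y']$ with $Y'$ an independent copy; $\mathrm{Var}[X_s\mid X_S]=\mathbb E_{x_S\sim\mu_S}\mathrm{Var}[(X_s\mid X_S=x_S)]$, computed in $\mu_{S\cup\{s\}}$. Total variation distance: $\max_A|P(A)-Q(A)|$.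
   Formalization: The local distributions $\mu_T$ take rational values, so all probabilities, conditional variances and the rounded distribution $\mu^{|S}$ are rational. -}

module Defs where

open import Data.Nat as ℕ using (ℕ; zero; suc)
open import Data.Bool using (Bool; true; false; if_then_else_) renaming (_≟_ to _≟B_)
open import Data.Fin using (Fin)
import Data.Fin as Fin
open import Data.Fin.Subset using (Subset; _∩_; _∪_; ⁅_⁆; ⊤; ∣_∣)
open import Data.Maybe using (Maybe; just; nothing)
import Data.Maybe.Properties as MaybeP
open import Data.Vec as Vec using (Vec; []; _∷_; lookup; zipWith)
import Data.Vec.Properties as VecP
open import Data.List as List using (List; [_]; concatMap; filter; allFin)
open import Data.Rational using (ℚ; 0ℚ; 1ℚ; _+_; _*_; _-_; _÷_; _≤_; ≢-nonZero)
import Data.Rational.Properties as ℚP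
open import Data.Product using (_×_)
open import Relation.Nullary using (yes; no; Dec)
open import Relation.Binary.PropositionalEquality using (_≡_)
open import Data.List.Membership.Propositional using (_∈_)

-- A (partial) assignment of values in [k] to variables in V = Fin n:
-- position i holds `just a` if variable i is assigned a, `nothing` otherwise.
PA : ℕ → ℕ → Set
PA n k = Vec (Maybe (Fin k)) n

_≟M_ : ∀ {k} (a b : Maybe (Fin k)) → Dec (a ≡ b)
_≟M_ = MaybeP.≡-dec Fin._≟_

_≟PA_ : ∀ {n k} (x y : PA n k) → Dec (x ≡ y)
_≟PA_ = VecP.≡-dec (MaybeP.≡-dec Fin._≟_)

-- All assignments [k]^T (partial assignments with domain exactly T).
asgs : ∀ {n} k → Subset n → List (PA n k)
asgs k []           = [ [] ]
asgs k (true ∷ T)   = concatMap (λ a → List.map (just a ∷_) (asgs k T)) (allFin k)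
asgs k (false ∷ T)  = List.map (nothing ∷_) (asgs k T)

restr : ∀ {n k} → Subset n → PA n k → PA n k
restr U x = zipWith (λ b m → if b then m else nothing) U x

Σ[_]_ : ∀ {A : Set} → List A → (A → ℚ) → ℚ
Σ[ xs ] f = List.foldr (λ x r → f x + r) 0ℚ xs

Π[_]_ : ∀ {A : Set} → List A → (A → ℚ) → ℚ
Π[ xs ] f = List.foldr (λ x r → f x * r) 1ℚ xs

-- Division, with the (irrelevant) convention p / 0 = 0.
_÷₀_ : ℚ → ℚ → ℚ
p ÷₀ q with q ℚP.≟ 0ℚ
... | yes _  = 0ℚ
... | no q≢0 = _÷_ p q {{≢-nonZero q≢0}}

IsDist : ∀ {n} k → Subset n → (PA n k → ℚ) → Set
IsDist k T p = (∀ x → x ∈ asgs k T → 0ℚ ≤ p x) × (Σ[ asgs k T ] p ≡ 1ℚ)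

-- Marginal on U of a distribution p over [k]^T (evaluated at y ∈ [k]^(T∩U)).
marg : ∀ {n} k → (T U : Subset n) → (PA n k → ℚ) → PA n k → ℚ
marg k T U p y = Σ[ filter (λ x → restr U x ≟PA y) (asgs k T) ] p

Prob : ∀ {n} k → Subset n → (PA n k → ℚ) → (PA n k → Bool) → ℚ
Prob k T p A = Σ[ List.filter (λ x → A x ≟B true) (asgs k T) ] p

record LocalDists (n k m : ℕ) : Set where
  field
    μ          : Subset n → PA n k → ℚ
    isDist     : ∀ T → ∣ T ∣ ℕ.≤ m → IsDist k T (μ T)
    consistent : ∀ T T' → ∣ T ∣ ℕ.≤ m → ∣ T' ∣ ℕ.≤ m →
                 ∀ y → y ∈ asgs k (T ∩ T') →
                 marg k T (T ∩ T') (μ T) y ≡ marg k T' (T ∩ T') (μ T') y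

module _ {n k m : ℕ} (L : LocalDists n k m) where
  open LocalDists L

  -- Pr_{μ_{S∪{i}}}[X_i = x_i | X_S = x_S] for a global assignment x.
  condProb : Subset n → Fin n → PA n k → ℚ
  condProb S i x =
    μ (S ∪ ⁅ i ⁆) (restr (S ∪ ⁅ i ⁆) x) ÷₀ marg k (S ∪ ⁅ i ⁆) S (μ (S ∪ ⁅ i ⁆)) (restr S x)

  -- μ^{|S}: output distribution of propagation rounding with seed set S,
  -- as a pmf over global assignments x ∈ [k]^V.
  propRound : Subset n → PA n k → ℚ
  propRound S x =
    μ S (restr S x) *
    Π[ filter (λ i → lookup S i ≟B false) (allFin n) ] (λ i → condProb S i x)

  propRoundMarg : Subset n → Subset n → PA n k → ℚ
  propRoundMarg S T = marg k ⊤ T (propRound S)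

  -- Var[X_s | X_S] = E_{x_S ~ μ_S} (1 - Σ_a Pr[X_s = a | X_S = x_S]^2),
  -- computed in μ_{S∪{s}}.
  condVar : Fin n → Subset n → ℚ
  condVar s S =
    Σ[ asgs k S ] (λ xS →
      μ S xS * (1ℚ - Σ[ allFin k ] (λ a →
        let pa = (Σ[ filter (λ z → lookup z s ≟M just a)
                           (filter (λ z → restr S z ≟PA xS) (asgs k (S ∪ ⁅ s ⁆))) ]
                   μ (S ∪ ⁅ s ⁆))
                 ÷₀ marg k (S ∪ ⁅ s ⁆) S (μ (S ∪ ⁅ s ⁆)) xS
        in pa * pa)))

-- Both μ_{S∪T} and the rounding output ν give the seed assignment x_S mass μ_S(x_S), and both give
-- each event {X_S = x_S, X_j = a} with j ∉ S the mass μ_{S∪{j}}, by consistency. Fix x_S and let c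
-- take, on each j ∈ T ∖ S, a most likely value of X_j given x_S. By a union bound, under either
-- distribution the part of the slice {X_S = x_S} that disagrees with c on T has mass at most
-- d(x_S) = Σ_{j ∈ T∖S} (μ_S(x_S) − Pr[X_S = x_S, X_j = c_j]), so the two masses of any event inside
-- the slice differ by at most d(x_S). Finally Σ_a p_a² ≤ max_a p_a bounds each term of d(x_S) by
-- μ_S(x_S) · Var[X_j | X_S = x_S]; summing over x_S gives the claim.
module Submission where

open import Defs

-- A module, so that the order _≤_ on ℚ used here does not clash with the order on ℕ in lemma8p1.
module Lemmas where

  open import Data.Nat as ℕ using (ℕ; zero; suc; s≤s; z≤n)
  import Data.Nat.Properties as ℕP
  open import Data.Bool using (Bool; true; false; if_then_else_; _∧_; _∨_; not) renaming (_≟_ to _≟B_)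
  import Data.Bool.Properties as BoolP
  open import Data.Fin as Fin using (Fin; zero; suc)
  import Data.Fin.Properties as FinP
  open import Data.Fin.Subset using (Subset; _∩_; _∪_; _─_; ⁅_⁆; ⊤; ∣_∣)
  open import Data.Fin.Subset.Properties using (_∈?_)
  import Data.Fin.Subset.Properties as SubP
  open import Data.Maybe using (Maybe; just; nothing)
  open import Data.Vec using ([]; _∷_; lookup; tabulate; _[_]≔_)
  import Data.Vec.Properties as VecP
  open import Data.List using (List; []; _∷_; _++_; map; concatMap; filter; allFin)
  open import Data.List.Properties using (map-tabulate)
  open import Data.List.Membership.Propositional using (_∈_)
  open import Data.List.Membership.Propositional.Properties using (∈-map⁺; ∈-map⁻; ∈-concatMap⁺; ∈-concatMap⁻; ∈-allFin)
  open import Data.List.Relation.Unary.Any using (here; there; satisfied)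
  import Data.List.Relation.Unary.Any as Any
  import Data.List.Relation.Unary.All as All
  open import Data.Rational as ℚ using (ℚ; 0ℚ; 1ℚ; _+_; _*_; _-_; -_; _≤_; 1/_)
  import Data.Rational.Properties as ℚP
  open import Data.Rational.Solver using (module +-*-Solver)
  open import Data.Product using (_×_; _,_; proj₁; proj₂)
  open import Data.Sum using (inj₁; inj₂)
  open import Data.Unit using (tt) renaming (⊤ to Unit)
  open import Data.Empty using (⊥; ⊥-elim)
  open import Function using (_∘_)
  open import Relation.Binary using (DecTotalOrder)
  open import Relation.Nullary using (Dec; yes; no; does)
  open import Relation.Unary using (Decidable)
  open import Relation.Binary.PropositionalEquality
  open import Data.List.Extrema (DecTotalOrder.totalOrder ℚP.≤-decTotalOrder) using (argmax; f[xs]≤f[argmax])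
  open +-*-Solver

  -- Rational arithmetic

  *-nonneg : ∀ {p q} → 0ℚ ≤ p → 0ℚ ≤ q → 0ℚ ≤ p * q
  *-nonneg {p} {q} 0≤p 0≤q =
    ℚP.nonNegative⁻¹ (p * q) {{ℚP.nonNeg*nonNeg⇒nonNeg p {{ℚ.nonNegative 0≤p}} q {{ℚ.nonNegative 0≤q}}}}

  *-monoʳ-≤-0≤ : ∀ {r} → 0ℚ ≤ r → ∀ {p q} → p ≤ q → p * r ≤ q * r
  *-monoʳ-≤-0≤ {r} 0≤r = ℚP.*-monoʳ-≤-nonNeg r {{ℚ.nonNegative 0≤r}}

  *-monoˡ-≤-0≤ : ∀ {r} → 0ℚ ≤ r → ∀ {p q} → p ≤ q → r * p ≤ r * q
  *-monoˡ-≤-0≤ {r} 0≤r = ℚP.*-monoˡ-≤-nonNeg r {{ℚ.nonNegative 0≤r}}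

  0≤1-p : ∀ {p} → p ≤ 1ℚ → 0ℚ ≤ 1ℚ - p
  0≤1-p {p} p≤1 = ℚP.≤-trans (ℚP.≤-reflexive (sym (ℚP.+-inverseʳ p))) (ℚP.+-monoˡ-≤ (- p) p≤1)

  inv₀ : ℚ → ℚ
  inv₀ q with q ℚP.≟ 0ℚ
  ... | yes _   = 0ℚ
  ... | no  q≢0 = (1/ q) {{ℚ.≢-nonZero q≢0}}

  ÷₀≡*inv₀ : ∀ p q → p ÷₀ q ≡ p * inv₀ q
  ÷₀≡*inv₀ p q with q ℚP.≟ 0ℚ
  ... | yes _ = sym (ℚP.*-zeroʳ p)
  ... | no  _ = refl

  *-inv₀ : ∀ q → q ≢ 0ℚ → q * inv₀ q ≡ 1ℚ
  *-inv₀ q q≢0 with q ℚP.≟ 0ℚ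
  ... | yes q≡0  = ⊥-elim (q≢0 q≡0)
  ... | no  q≢0′ = ℚP.*-inverseʳ q {{ℚ.≢-nonZero q≢0′}}

  inv₀-nonneg : ∀ {q} → 0ℚ ≤ q → 0ℚ ≤ inv₀ q
  inv₀-nonneg {q} 0≤q with q ℚP.≟ 0ℚ
  ... | yes _   = ℚP.≤-refl
  ... | no  q≢0 = ℚP.<⇒≤ (ℚP.positive⁻¹ _ {{ℚP.1/pos⇒pos q
                    {{ℚP.nonNeg∧nonZero⇒pos q {{ℚ.nonNegative 0≤q}} {{ℚ.≢-nonZero q≢0}}}}}})

  ÷₀-nonneg : ∀ {p q} → 0ℚ ≤ p → 0ℚ ≤ q → 0ℚ ≤ p ÷₀ q
  ÷₀-nonneg {p} {q} 0≤p 0≤q = subst (0ℚ ≤_) (sym (÷₀≡*inv₀ p q)) (*-nonneg 0≤p (inv₀-nonneg 0≤q))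

  ÷₀-monoˡ-≤ : ∀ {p p′ q} → 0ℚ ≤ q → p ≤ p′ → p ÷₀ q ≤ p′ ÷₀ q
  ÷₀-monoˡ-≤ {p} {p′} {q} 0≤q p≤p′ rewrite ÷₀≡*inv₀ p q | ÷₀≡*inv₀ p′ q =
    *-monoʳ-≤-0≤ (inv₀-nonneg 0≤q) p≤p′

  ÷₀-self : ∀ q → q ≢ 0ℚ → q ÷₀ q ≡ 1ℚ
  ÷₀-self q q≢0 = trans (÷₀≡*inv₀ q q) (*-inv₀ q q≢0)

  -- The side condition makes the identity hold also for q = 0, where p ÷₀ 0 = 0.
  *-÷₀-cancel : ∀ q p → (q ≡ 0ℚ → p ≡ 0ℚ) → q * (p ÷₀ q) ≡ p
  *-÷₀-cancel q p q≡0⇒p≡0 = trans (cong (q *_) (÷₀≡*inv₀ p q)) (cancel (q ℚP.≟ 0ℚ))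
    where
    cancel : Dec (q ≡ 0ℚ) → q * (p * inv₀ q) ≡ p
    cancel (yes q≡0) = trans (cong (_* (p * inv₀ q)) q≡0) (trans (ℚP.*-zeroˡ (p * inv₀ q)) (sym (q≡0⇒p≡0 q≡0)))
    cancel (no  q≢0) = trans (solve 3 (λ q p i → q :* (p :* i) := p :* (q :* i)) refl q p (inv₀ q))
                             (trans (cong (p *_) (*-inv₀ q q≢0)) (ℚP.*-identityʳ p))

  p≤q⇒p÷₀q≤1 : ∀ {p q} → 0ℚ ≤ q → p ≤ q → p ÷₀ q ≤ 1ℚ
  p≤q⇒p÷₀q≤1 {p} {q} 0≤q p≤q = subst (_≤ 1ℚ) (sym (÷₀≡*inv₀ p q)) (bound (q ℚP.≟ 0ℚ))
    where
    bound : Dec (q ≡ 0ℚ) → p * inv₀ q ≤ 1ℚ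
    bound (yes q≡0) =
      subst (λ r → p * inv₀ r ≤ 1ℚ) (sym q≡0) (subst (_≤ 1ℚ) (sym (ℚP.*-zeroʳ p)) (ℚP.nonNegative⁻¹ 1ℚ))
    bound (no  q≢0) = ℚP.≤-trans (*-monoʳ-≤-0≤ (inv₀-nonneg 0≤q) p≤q) (ℚP.≤-reflexive (*-inv₀ q q≢0))

  ∣p-q∣≤hi-lo : ∀ {lo hi p q} → lo ≤ p → p ≤ hi → lo ≤ q → q ≤ hi → ℚ.∣ p - q ∣ ≤ hi - lo
  ∣p-q∣≤hi-lo {lo} {hi} {p} {q} lo≤p p≤hi lo≤q q≤hi with ℚP.∣p∣≡p∨∣p∣≡-p (p - q)
  ... | inj₁ ∣p-q∣≡p-q  = subst (_≤ hi - lo) (sym ∣p-q∣≡p-q) (ℚP.+-mono-≤ p≤hi (ℚP.neg-antimono-≤ lo≤q))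
  ... | inj₂ ∣p-q∣≡q-p = subst (_≤ hi - lo) (sym (trans ∣p-q∣≡q-p (q-p≡-[p-q])))
                               (ℚP.+-mono-≤ q≤hi (ℚP.neg-antimono-≤ lo≤p))
    where
    q-p≡-[p-q] : - (p - q) ≡ q - p
    q-p≡-[p-q] = solve 2 (λ p q → :- (p :- q) := q :- p) refl p q

  -- Where the A-mass p of a slice of total mass D can lie when all but mass d of the slice
  -- sits on one point g; the Boolean says whether g ∈ A.
  Window : Bool → (D d p : ℚ) → Set
  Window true  D d p = D - d ≤ p × p ≤ D
  Window false D d p = 0ℚ ≤ p × p ≤ d

  ∣p-q∣≤window : ∀ b {D d p q} → Window b D d p → Window b D d q → ℚ.∣ p - q ∣ ≤ d
  ∣p-q∣≤window true  {D} {d} (lo≤p , p≤hi) (lo≤q , q≤hi) =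
    subst (ℚ.∣ _ ∣ ≤_) (solve 2 (λ D d → D :- (D :- d) := d) refl D d) (∣p-q∣≤hi-lo lo≤p p≤hi lo≤q q≤hi)
  ∣p-q∣≤window false {D} {d} (lo≤p , p≤hi) (lo≤q , q≤hi) =
    subst (ℚ.∣ _ ∣ ≤_) (ℚP.+-identityʳ d) (∣p-q∣≤hi-lo lo≤p p≤hi lo≤q q≤hi)

  -- Indicator weights and finite sums

  mask : Bool → ℚ → ℚ
  mask b x = if b then x else 0ℚ

  mask-*ˡ : ∀ b x y → mask b x * y ≡ mask b (x * y)
  mask-*ˡ true  x y = refl
  mask-*ˡ false x y = ℚP.*-zeroˡ y

  mask-*ʳ : ∀ b x y → x * mask b y ≡ mask b (x * y)
  mask-*ʳ true  x y = refl
  mask-*ʳ false x y = ℚP.*-zeroʳ x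

  mask-∧ : ∀ b c x → mask (b ∧ c) x ≡ mask b (mask c x)
  mask-∧ true  c x = refl
  mask-∧ false c x = refl

  mask-comm : ∀ b c x → mask b (mask c x) ≡ mask c (mask b x)
  mask-comm true  c     x = refl
  mask-comm false true  x = refl
  mask-comm false false x = refl

  mask-not : ∀ b x → mask (not b) x ≡ x - mask b x
  mask-not true  x = sym (ℚP.+-inverseʳ x)
  mask-not false x = sym (ℚP.+-identityʳ x)

  mask-distrib-- : ∀ b x y → mask b (x - y) ≡ mask b x - mask b y
  mask-distrib-- true  x y = refl
  mask-distrib-- false x y = refl

  mask-nonneg : ∀ b {x} → 0ℚ ≤ x → 0ℚ ≤ mask b x
  mask-nonneg true  0≤x = 0≤x
  mask-nonneg false 0≤x = ℚP.≤-refl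

  mask-≤ : ∀ b {x} → 0ℚ ≤ x → mask b x ≤ x
  mask-≤ true  0≤x = ℚP.≤-refl
  mask-≤ false 0≤x = 0≤x

  mask-mono : ∀ b {x y} → x ≤ y → mask b x ≤ mask b y
  mask-mono true  x≤y = x≤y
  mask-mono false x≤y = ℚP.≤-refl

  mask-does-cong : ∀ {A : Set} {a b : A} (a≟b : Dec (a ≡ b)) {x y : ℚ} →
                   (a ≡ b → x ≡ y) → mask (does a≟b) x ≡ mask (does a≟b) y
  mask-does-cong (yes a≡b) x≡y = x≡y a≡b
  mask-does-cong (no  _)   x≡y = refl

  mask-does-mono : ∀ {A : Set} {a b : A} (a≟b : Dec (a ≡ b)) {x y : ℚ} →
                   (a ≡ b → x ≤ y) → mask (does a≟b) x ≤ mask (does a≟b) y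
  mask-does-mono (yes a≡b) x≤y = x≤y a≡b
  mask-does-mono (no  _)   x≤y = ℚP.≤-refl

  does-sym : ∀ {A : Set} {x y : A} (x≟y : Dec (x ≡ y)) (y≟x : Dec (y ≡ x)) → does x≟y ≡ does y≟x
  does-sym (yes _)   (yes _)   = refl
  does-sym (yes x≡y) (no y≢x)  = ⊥-elim (y≢x (sym x≡y))
  does-sym (no x≢y)  (yes y≡x) = ⊥-elim (x≢y (sym y≡x))
  does-sym (no _)    (no _)    = refl

  module _ {A : Set} where

    Σ-cong : ∀ (xs : List A) {f g : A → ℚ} → (∀ x → f x ≡ g x) → Σ[ xs ] f ≡ Σ[ xs ] g
    Σ-cong []       f≗g = refl
    Σ-cong (x ∷ xs) f≗g = cong₂ _+_ (f≗g x) (Σ-cong xs f≗g)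

    Σ-cong-∈ : ∀ (xs : List A) {f g : A → ℚ} → (∀ x → x ∈ xs → f x ≡ g x) → Σ[ xs ] f ≡ Σ[ xs ] g
    Σ-cong-∈ []       f≗g = refl
    Σ-cong-∈ (x ∷ xs) f≗g = cong₂ _+_ (f≗g x (here refl)) (Σ-cong-∈ xs (λ y y∈ → f≗g y (there y∈)))

    Σ-0 : ∀ (xs : List A) → Σ[ xs ] (λ _ → 0ℚ) ≡ 0ℚ
    Σ-0 []       = refl
    Σ-0 (x ∷ xs) = trans (ℚP.+-identityˡ _) (Σ-0 xs)

    Σ-+ : ∀ (xs : List A) (f g : A → ℚ) → Σ[ xs ] (λ x → f x + g x) ≡ Σ[ xs ] f + Σ[ xs ] g
    Σ-+ []       f g = refl
    Σ-+ (x ∷ xs) f g rewrite Σ-+ xs f g =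
      solve 4 (λ a b c d → (a :+ b) :+ (c :+ d) := (a :+ c) :+ (b :+ d)) refl (f x) (g x) (Σ[ xs ] f) (Σ[ xs ] g)

    Σ-- : ∀ (xs : List A) (f g : A → ℚ) → Σ[ xs ] (λ x → f x - g x) ≡ Σ[ xs ] f - Σ[ xs ] g
    Σ-- []       f g = refl
    Σ-- (x ∷ xs) f g rewrite Σ-- xs f g =
      solve 4 (λ a b c d → (a :- b) :+ (c :- d) := (a :+ c) :- (b :+ d)) refl (f x) (g x) (Σ[ xs ] f) (Σ[ xs ] g)

    Σ-*ˡ : ∀ (xs : List A) (c : ℚ) (f : A → ℚ) → Σ[ xs ] (λ x → c * f x) ≡ c * Σ[ xs ] f
    Σ-*ˡ []       c f = sym (ℚP.*-zeroʳ c)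
    Σ-*ˡ (x ∷ xs) c f rewrite Σ-*ˡ xs c f = sym (ℚP.*-distribˡ-+ c (f x) (Σ[ xs ] f))

    Σ-*ʳ : ∀ (xs : List A) (c : ℚ) (f : A → ℚ) → Σ[ xs ] (λ x → f x * c) ≡ Σ[ xs ] f * c
    Σ-*ʳ xs c f = trans (Σ-cong xs (λ x → ℚP.*-comm (f x) c)) (trans (Σ-*ˡ xs c f) (ℚP.*-comm c _))

    Σ-mask : ∀ (xs : List A) b (f : A → ℚ) → Σ[ xs ] (λ x → mask b (f x)) ≡ mask b (Σ[ xs ] f)
    Σ-mask xs true  f = refl
    Σ-mask xs false f = Σ-0 xs

    Σ-++ : ∀ (xs ys : List A) (f : A → ℚ) → Σ[ xs ++ ys ] f ≡ Σ[ xs ] f + Σ[ ys ] f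
    Σ-++ []       ys f = sym (ℚP.+-identityˡ _)
    Σ-++ (x ∷ xs) ys f rewrite Σ-++ xs ys f = sym (ℚP.+-assoc (f x) _ _)

    Σ-filter : ∀ {P : A → Set} (P? : Decidable P) (xs : List A) (f : A → ℚ) →
               Σ[ filter P? xs ] f ≡ Σ[ xs ] (λ x → mask (does (P? x)) (f x))
    Σ-filter P? []       f = refl
    Σ-filter P? (x ∷ xs) f with does (P? x)
    ... | true  = cong (f x +_) (Σ-filter P? xs f)
    ... | false = trans (Σ-filter P? xs f) (sym (ℚP.+-identityˡ _))

    Σ-mono-∈ : ∀ (xs : List A) {f g : A → ℚ} → (∀ x → x ∈ xs → f x ≤ g x) → Σ[ xs ] f ≤ Σ[ xs ] g
    Σ-mono-∈ []       f≤g = ℚP.≤-refl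
    Σ-mono-∈ (x ∷ xs) f≤g = ℚP.+-mono-≤ (f≤g x (here refl)) (Σ-mono-∈ xs (λ y y∈ → f≤g y (there y∈)))

    Σ-mono : ∀ (xs : List A) {f g : A → ℚ} → (∀ x → f x ≤ g x) → Σ[ xs ] f ≤ Σ[ xs ] g
    Σ-mono xs f≤g = Σ-mono-∈ xs (λ x _ → f≤g x)

    Σ-nonneg : ∀ (xs : List A) {f : A → ℚ} → (∀ x → x ∈ xs → 0ℚ ≤ f x) → 0ℚ ≤ Σ[ xs ] f
    Σ-nonneg xs {f} 0≤f = subst (_≤ Σ[ xs ] f) (Σ-0 xs) (Σ-mono-∈ xs 0≤f)

    term≤Σ : ∀ (xs : List A) (f : A → ℚ) {x} → x ∈ xs → (∀ y → 0ℚ ≤ f y) → f x ≤ Σ[ xs ] f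
    term≤Σ (y ∷ xs) f (here refl) 0≤f =
      ℚP.≤-trans (ℚP.≤-reflexive (sym (ℚP.+-identityʳ (f y))))
                 (ℚP.+-monoʳ-≤ (f y) (Σ-nonneg xs (λ z _ → 0≤f z)))
    term≤Σ (y ∷ xs) f (there x∈) 0≤f =
      ℚP.≤-trans (term≤Σ xs f x∈ 0≤f)
        (ℚP.≤-trans (ℚP.≤-reflexive (sym (ℚP.+-identityˡ _))) (ℚP.+-monoˡ-≤ (Σ[ xs ] f) (0≤f y)))

  module _ {A B : Set} where

    Σ-map : ∀ (h : A → B) (xs : List A) (f : B → ℚ) → Σ[ map h xs ] f ≡ Σ[ xs ] (f ∘ h)
    Σ-map h []       f = refl
    Σ-map h (x ∷ xs) f = cong (f (h x) +_) (Σ-map h xs f)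

    Σ-concatMap : ∀ (h : A → List B) (xs : List A) (f : B → ℚ) →
                  Σ[ concatMap h xs ] f ≡ Σ[ xs ] (λ x → Σ[ h x ] f)
    Σ-concatMap h []       f = refl
    Σ-concatMap h (x ∷ xs) f =
      trans (Σ-++ (h x) (concatMap h xs) f) (cong (Σ[ h x ] f +_) (Σ-concatMap h xs f))

    Σ-swap : ∀ (xs : List A) (ys : List B) (f : A → B → ℚ) →
             Σ[ xs ] (λ x → Σ[ ys ] (f x)) ≡ Σ[ ys ] (λ y → Σ[ xs ] (λ x → f x y))
    Σ-swap []       ys f = sym (Σ-0 ys)
    Σ-swap (x ∷ xs) ys f rewrite Σ-swap xs ys f = sym (Σ-+ ys (f x) (λ y → Σ[ xs ] (λ x → f x y)))

  Σ-÷₀ : ∀ {A : Set} (xs : List A) (f : A → ℚ) q → Σ[ xs ] (λ x → f x ÷₀ q) ≡ (Σ[ xs ] f) ÷₀ q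
  Σ-÷₀ xs f q = trans (Σ-cong xs (λ x → ÷₀≡*inv₀ (f x) q)) (trans (Σ-*ʳ xs (inv₀ q) f) (sym (÷₀≡*inv₀ _ q)))

  ∣Σ-Σ∣≤Σ∣-∣ : ∀ {A : Set} (xs : List A) (f g : A → ℚ) →
               ℚ.∣ Σ[ xs ] f - Σ[ xs ] g ∣ ≤ Σ[ xs ] (λ x → ℚ.∣ f x - g x ∣)
  ∣Σ-Σ∣≤Σ∣-∣ []       f g = ℚP.≤-refl
  ∣Σ-Σ∣≤Σ∣-∣ (x ∷ xs) f g =
    ℚP.≤-trans (ℚP.≤-reflexive (cong ℚ.∣_∣ (sym (Σ-- (x ∷ xs) f g))))
      (ℚP.≤-trans (ℚP.∣p+q∣≤∣p∣+∣q∣ (f x - g x) (Σ[ xs ] (λ y → f y - g y)))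
        (ℚP.+-monoʳ-≤ ℚ.∣ f x - g x ∣
          (ℚP.≤-trans (ℚP.≤-reflexive (cong ℚ.∣_∣ (Σ-- xs f g))) (∣Σ-Σ∣≤Σ∣-∣ xs f g))))

  -- Sums and products over Fin n and its subsets

  Σ-allFin-suc : ∀ {k} (f : Fin (suc k) → ℚ) → Σ[ allFin (suc k) ] f ≡ f zero + Σ[ allFin k ] (f ∘ suc)
  Σ-allFin-suc {k} f = cong (f zero +_) (trans (cong (Σ[_] f) (sym (map-tabulate (λ i → i) suc))) (Σ-map suc (allFin k) f))

  Π-allFin-suc : ∀ {k} (f : Fin (suc k) → ℚ) → Π[ allFin (suc k) ] f ≡ f zero * Π[ allFin k ] (f ∘ suc)
  Π-allFin-suc {k} f = cong (f zero *_) (trans (cong (Π[_] f) (sym (map-tabulate (λ i → i) suc))) (Π-map (allFin k)))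
    where
    Π-map : ∀ (xs : List (Fin k)) → Π[ map suc xs ] f ≡ Π[ xs ] (f ∘ suc)
    Π-map []       = refl
    Π-map (x ∷ xs) = cong (f (suc x) *_) (Π-map xs)

  Σ-allFin-δ : ∀ {k} (a : Fin k) (f : Fin k → ℚ) → Σ[ allFin k ] (λ b → mask (does (a Fin.≟ b)) (f b)) ≡ f a
  Σ-allFin-δ {suc k} zero f =
    trans (Σ-allFin-suc (λ b → mask (does (zero Fin.≟ b)) (f b)))
          (trans (cong (f zero +_) (Σ-0 (allFin k))) (ℚP.+-identityʳ (f zero)))
  Σ-allFin-δ {suc k} (suc a) f =
    trans (Σ-allFin-suc (λ b → mask (does (suc a Fin.≟ b)) (f b)))
          (trans (ℚP.+-identityˡ _) (Σ-allFin-δ a (f ∘ suc)))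

  Σ-allFin-δ′ : ∀ {k} (a : Fin k) (f : Fin k → ℚ) → Σ[ allFin k ] (λ b → mask (does (b Fin.≟ a)) (f b)) ≡ f a
  Σ-allFin-δ′ {k} a f =
    trans (Σ-cong (allFin k) (λ b → cong (λ c → mask c (f b)) (does-sym (b Fin.≟ a) (a Fin.≟ b)))) (Σ-allFin-δ a f)

  -- Σ p_a² ≤ max_a p_a · Σ p_a = max_a p_a, where p_a = N a / D.
  off-mode≤variance : ∀ {k} (N : Fin k → ℚ) {D} (a* : Fin k) → (∀ b → 0ℚ ≤ N b) → (∀ b → N b ≤ N a*) →
                      Σ[ allFin k ] N ≡ D →
                      D - N a* ≤ D * (1ℚ - Σ[ allFin k ] (λ a → (N a ÷₀ D) * (N a ÷₀ D)))
  off-mode≤variance {k} N {D} a* 0≤N N≤N* ΣN≡D = by-cases (D ℚP.≟ 0ℚ)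
    where
    p : Fin k → ℚ
    p a = N a ÷₀ D
    Σp² : ℚ
    Σp² = Σ[ allFin k ] (λ a → p a * p a)
    D-_ : ℚ → ℚ
    D- x = D - x

    D·p≡N : D ≢ 0ℚ → ∀ a → D * p a ≡ N a
    D·p≡N D≢0 a = *-÷₀-cancel D (N a) (λ D≡0 → ⊥-elim (D≢0 D≡0))
    N·p≤N·p* : ∀ a → N a * p a ≤ N a * p a*
    N·p≤N·p* a =
      *-monoˡ-≤-0≤ (0≤N a) (÷₀-monoˡ-≤ (subst (0ℚ ≤_) ΣN≡D (Σ-nonneg (allFin k) (λ b _ → 0≤N b))) (N≤N* a))

    by-cases : Dec (D ≡ 0ℚ) → D - N a* ≤ D * (1ℚ - Σp²)
    by-cases (yes D≡0) = ℚP.≤-reflexive (begin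
        D - N a*        ≡⟨ cong₂ _-_ D≡0 N*≡0 ⟩
        0ℚ - 0ℚ         ≡⟨ sym (ℚP.*-zeroˡ (1ℚ - Σp²)) ⟩
        0ℚ * (1ℚ - Σp²) ≡⟨ cong (_* (1ℚ - Σp²)) (sym D≡0) ⟩
        D * (1ℚ - Σp²)  ∎)
      where
      open ≡-Reasoning
      N*≡0 : N a* ≡ 0ℚ
      N*≡0 = ℚP.≤-antisym
        (ℚP.≤-trans (term≤Σ (allFin k) N (∈-allFin a*) 0≤N) (ℚP.≤-reflexive (trans ΣN≡D D≡0))) (0≤N a*)
    by-cases (no D≢0) = begin
        D - N a*                                 ≡⟨ cong D-_ (sym ΣN·p*≡N*) ⟩
        D - Σ[ allFin k ] (λ a → N a * p a*)      ≤⟨ ℚP.+-monoʳ-≤ D (ℚP.neg-antimono-≤ (Σ-mono (allFin k) N·p≤N·p*)) ⟩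
        D - Σ[ allFin k ] (λ a → N a * p a)       ≡⟨ cong D-_ (Σ-cong (allFin k) N·p≡D·p²) ⟩
        D - Σ[ allFin k ] (λ a → D * (p a * p a)) ≡⟨ cong D-_ (Σ-*ˡ (allFin k) D (λ a → p a * p a)) ⟩
        D - D * Σp²                              ≡⟨ solve 2 (λ D s → D :- D :* s := D :* (con 1ℚ :- s)) refl D Σp² ⟩
        D * (1ℚ - Σp²)                           ∎
      where
      open ℚP.≤-Reasoning
      ΣN·p*≡N* : Σ[ allFin k ] (λ a → N a * p a*) ≡ N a*
      ΣN·p*≡N* = trans (Σ-*ʳ (allFin k) (p a*) N) (trans (cong (_* p a*) ΣN≡D) (D·p≡N D≢0 a*))
      N·p≡D·p² : ∀ a → N a * p a ≡ D * (p a * p a)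
      N·p≡D·p² a = trans (cong (_* p a) (sym (D·p≡N D≢0 a))) (ℚP.*-assoc D (p a) (p a))

  Π[∉_]_ : ∀ {n} → Subset n → (Fin n → ℚ) → ℚ
  Π[∉ [] ]        f = 1ℚ
  Π[∉ true  ∷ S ] f = Π[∉ S ] (f ∘ suc)
  Π[∉ false ∷ S ] f = f zero * Π[∉ S ] (f ∘ suc)

  Σ[∈_]_ : ∀ {n} → Subset n → (Fin n → ℚ) → ℚ
  Σ[∈ [] ]        f = 0ℚ
  Σ[∈ true  ∷ T ] f = f zero + Σ[∈ T ] (f ∘ suc)
  Σ[∈ false ∷ T ] f = Σ[∈ T ] (f ∘ suc)

  Π-filter-∉ : ∀ {n} (S : Subset n) (f : Fin n → ℚ) →
               Π[ filter (λ i → lookup S i ≟B false) (allFin n) ] f ≡ Π[∉ S ] f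
  Π-filter-∉ {n} S f = trans (Π-filter (allFin n)) (Π-allFin-∉ S f)
    where
    keep : ∀ {n} → Subset n → (Fin n → ℚ) → Fin n → ℚ
    keep S f i = if does (lookup S i ≟B false) then f i else 1ℚ
    Π-filter : ∀ xs → Π[ filter (λ i → lookup S i ≟B false) xs ] f ≡ Π[ xs ] (keep S f)
    Π-filter []       = refl
    Π-filter (i ∷ xs) with does (lookup S i ≟B false)
    ... | true  = cong (f i *_) (Π-filter xs)
    ... | false = trans (Π-filter xs) (sym (ℚP.*-identityˡ _))
    Π-allFin-∉ : ∀ {n} (S : Subset n) (f : Fin n → ℚ) →
                 Π[ allFin n ] (keep S f) ≡ Π[∉ S ] f
    Π-allFin-∉ []          f = refl
    Π-allFin-∉ (true ∷ S)  f =
      trans (Π-allFin-suc (keep (true ∷ S) f)) (trans (ℚP.*-identityˡ _) (Π-allFin-∉ S (f ∘ suc)))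
    Π-allFin-∉ (false ∷ S) f =
      trans (Π-allFin-suc (keep (false ∷ S) f)) (cong (f zero *_) (Π-allFin-∉ S (f ∘ suc)))

  Π∉-cong : ∀ {n} (S : Subset n) {f g : Fin n → ℚ} → (∀ j → lookup S j ≡ false → f j ≡ g j) →
            Π[∉ S ] f ≡ Π[∉ S ] g
  Π∉-cong []          f≗g = refl
  Π∉-cong (true ∷ S)  f≗g = Π∉-cong S (f≗g ∘ suc)
  Π∉-cong (false ∷ S) f≗g = cong₂ _*_ (f≗g zero refl) (Π∉-cong S (f≗g ∘ suc))

  Π∉-≡1 : ∀ {n} (S : Subset n) (f : Fin n → ℚ) → (∀ j → lookup S j ≡ false → f j ≡ 1ℚ) → Π[∉ S ] f ≡ 1ℚ
  Π∉-≡1 []          f f≡1 = refl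
  Π∉-≡1 (true ∷ S)  f f≡1 = Π∉-≡1 S (f ∘ suc) (f≡1 ∘ suc)
  Π∉-≡1 (false ∷ S) f f≡1 = trans (cong₂ _*_ (f≡1 zero refl) (Π∉-≡1 S (f ∘ suc) (f≡1 ∘ suc))) (ℚP.*-identityˡ 1ℚ)

  Π∉-single : ∀ {n} (S : Subset n) (f : Fin n → ℚ) i → lookup S i ≡ false →
              (∀ j → lookup S j ≡ false → j ≢ i → f j ≡ 1ℚ) → Π[∉ S ] f ≡ f i
  Π∉-single (false ∷ S) f zero    _   f≡1 =
    trans (cong (f zero *_) (Π∉-≡1 S (f ∘ suc) (λ j j∉S → f≡1 (suc j) j∉S (λ ())))) (ℚP.*-identityʳ (f zero))
  Π∉-single (true ∷ S)  f (suc i) i∉S f≡1 =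
    Π∉-single S (f ∘ suc) i i∉S (λ j j∉S j≢i → f≡1 (suc j) j∉S (j≢i ∘ FinP.suc-injective))
  Π∉-single (false ∷ S) f (suc i) i∉S f≡1 =
    trans (cong (_* Π[∉ S ] (f ∘ suc)) (f≡1 zero refl (λ ())))
          (trans (ℚP.*-identityˡ _)
                 (Π∉-single S (f ∘ suc) i i∉S (λ j j∉S j≢i → f≡1 (suc j) j∉S (j≢i ∘ FinP.suc-injective))))

  Π∉-scale : ∀ {n} (S : Subset n) (f : Fin n → ℚ) i (e : ℚ) → lookup S i ≡ false →
             e * Π[∉ S ] f ≡ Π[∉ S ] (λ j → if does (j Fin.≟ i) then e * f j else f j)
  Π∉-scale (false ∷ S) f zero    e _ =
    sym (ℚP.*-assoc e (f zero) _)
  Π∉-scale (true ∷ S)  f (suc i) e i∉S = Π∉-scale S (f ∘ suc) i e i∉S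
  Π∉-scale (false ∷ S) f (suc i) e i∉S =
    trans (solve 3 (λ e a p → e :* (a :* p) := a :* (e :* p)) refl e (f zero) (Π[∉ S ] (f ∘ suc)))
          (cong (f zero *_) (Π∉-scale S (f ∘ suc) i e i∉S))

  Π∉-nonneg : ∀ {n} (S : Subset n) (f : Fin n → ℚ) → (∀ j → lookup S j ≡ false → 0ℚ ≤ f j) → 0ℚ ≤ Π[∉ S ] f
  Π∉-nonneg []          f 0≤f = ℚP.nonNegative⁻¹ 1ℚ
  Π∉-nonneg (true ∷ S)  f 0≤f = Π∉-nonneg S (f ∘ suc) (0≤f ∘ suc)
  Π∉-nonneg (false ∷ S) f 0≤f = *-nonneg (0≤f zero refl) (Π∉-nonneg S (f ∘ suc) (0≤f ∘ suc))

  Σ-filter-∈ : ∀ {n} (T : Subset n) (f : Fin n → ℚ) → Σ[ filter (_∈? T) (allFin n) ] f ≡ Σ[∈ T ] f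
  Σ-filter-∈ {n} T f = trans (Σ-filter (_∈? T) (allFin n) f) (Σ-allFin-∈ T f)
    where
    Σ-allFin-∈ : ∀ {n} (T : Subset n) (f : Fin n → ℚ) → Σ[ allFin n ] (λ s → mask (does (s ∈? T)) (f s)) ≡ Σ[∈ T ] f
    Σ-allFin-∈ []          f = refl
    Σ-allFin-∈ (true ∷ T)  f =
      trans (Σ-allFin-suc (λ s → mask (does (s ∈? true ∷ T)) (f s))) (cong (f zero +_) (Σ-allFin-∈ T (f ∘ suc)))
    Σ-allFin-∈ (false ∷ T) f =
      trans (Σ-allFin-suc (λ s → mask (does (s ∈? false ∷ T)) (f s))) (trans (ℚP.+-identityˡ _) (Σ-allFin-∈ T (f ∘ suc)))

  Σ∈-0 : ∀ {n} (T : Subset n) → Σ[∈ T ] (λ _ → 0ℚ) ≡ 0ℚ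
  Σ∈-0 []          = refl
  Σ∈-0 (true ∷ T)  = trans (ℚP.+-identityˡ _) (Σ∈-0 T)
  Σ∈-0 (false ∷ T) = Σ∈-0 T

  Σ∈-mono : ∀ {n} (T : Subset n) {f g : Fin n → ℚ} → (∀ j → lookup T j ≡ true → f j ≤ g j) →
            Σ[∈ T ] f ≤ Σ[∈ T ] g
  Σ∈-mono []          f≤g = ℚP.≤-refl
  Σ∈-mono (true ∷ T)  f≤g = ℚP.+-mono-≤ (f≤g zero refl) (Σ∈-mono T (f≤g ∘ suc))
  Σ∈-mono (false ∷ T) f≤g = Σ∈-mono T (f≤g ∘ suc)

  Σ∈-nonneg : ∀ {n} (T : Subset n) {f : Fin n → ℚ} → (∀ j → lookup T j ≡ true → 0ℚ ≤ f j) → 0ℚ ≤ Σ[∈ T ] f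
  Σ∈-nonneg T {f} 0≤f = subst (_≤ Σ[∈ T ] f) (Σ∈-0 T) (Σ∈-mono T 0≤f)

  mask-Σ∈ : ∀ {n} (T : Subset n) b (f : Fin n → ℚ) → mask b (Σ[∈ T ] f) ≡ Σ[∈ T ] (λ j → mask b (f j))
  mask-Σ∈ T true  f = refl
  mask-Σ∈ T false f = sym (Σ∈-0 T)

  Σ-Σ∈ : ∀ {A : Set} {n} (T : Subset n) (xs : List A) (f : A → Fin n → ℚ) →
         Σ[ xs ] (λ x → Σ[∈ T ] (f x)) ≡ Σ[∈ T ] (λ j → Σ[ xs ] (λ x → f x j))
  Σ-Σ∈ []          xs f = Σ-0 xs
  Σ-Σ∈ (true ∷ T)  xs f =
    trans (Σ-+ xs (λ x → f x zero) (λ x → Σ[∈ T ] (f x ∘ suc)))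
          (cong (Σ[ xs ] (λ x → f x zero) +_) (Σ-Σ∈ T xs (λ x → f x ∘ suc)))
  Σ-Σ∈ (false ∷ T) xs f = Σ-Σ∈ T xs (λ x → f x ∘ suc)

  Σ∈─≤Σ∈ : ∀ {n} (T S : Subset n) (f : Fin n → ℚ) → (∀ j → lookup T j ≡ true → 0ℚ ≤ f j) →
           Σ[∈ T ─ S ] f ≤ Σ[∈ T ] f
  Σ∈─≤Σ∈ []          []          f 0≤f = ℚP.≤-refl
  Σ∈─≤Σ∈ (true ∷ T)  (true ∷ S)  f 0≤f =
    ℚP.≤-trans (ℚP.≤-reflexive (sym (ℚP.+-identityˡ _)))
               (ℚP.+-mono-≤ (0≤f zero refl) (Σ∈─≤Σ∈ T S (f ∘ suc) (0≤f ∘ suc)))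
  Σ∈─≤Σ∈ (true ∷ T)  (false ∷ S) f 0≤f = ℚP.+-monoʳ-≤ (f zero) (Σ∈─≤Σ∈ T S (f ∘ suc) (0≤f ∘ suc))
  Σ∈─≤Σ∈ (false ∷ T) (true ∷ S)  f 0≤f = Σ∈─≤Σ∈ T S (f ∘ suc) (0≤f ∘ suc)
  Σ∈─≤Σ∈ (false ∷ T) (false ∷ S) f 0≤f = Σ∈─≤Σ∈ T S (f ∘ suc) (0≤f ∘ suc)

  lookup-─ : ∀ {n} (T S : Subset n) j → lookup (T ─ S) j ≡ true → lookup T j ≡ true × lookup S j ≡ false
  lookup-─ (true ∷ T)  (false ∷ S) zero    refl = refl , refl
  lookup-─ (_ ∷ T)     (true ∷ S)  (suc j) j∈   = lookup-─ T S j j∈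
  lookup-─ (_ ∷ T)     (false ∷ S) (suc j) j∈   = lookup-─ T S j j∈

  ∣p∪q∣≤∣p∣+∣q∣ : ∀ {n} (p q : Subset n) → ∣ p ∪ q ∣ ℕ.≤ ∣ p ∣ ℕ.+ ∣ q ∣
  ∣p∪q∣≤∣p∣+∣q∣ []         []         = z≤n
  ∣p∪q∣≤∣p∣+∣q∣ (true ∷ p)  (true ∷ q)  = s≤s (ℕP.≤-trans (∣p∪q∣≤∣p∣+∣q∣ p q) (ℕP.+-monoʳ-≤ ∣ p ∣ (ℕP.n≤1+n ∣ q ∣)))
  ∣p∪q∣≤∣p∣+∣q∣ (true ∷ p)  (false ∷ q) = s≤s (∣p∪q∣≤∣p∣+∣q∣ p q)
  ∣p∪q∣≤∣p∣+∣q∣ (false ∷ p) (true ∷ q)  = subst (suc ∣ p ∪ q ∣ ℕ.≤_) (sym (ℕP.+-suc ∣ p ∣ ∣ q ∣)) (s≤s (∣p∪q∣≤∣p∣+∣q∣ p q))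
  ∣p∪q∣≤∣p∣+∣q∣ (false ∷ p) (false ∷ q) = ∣p∪q∣≤∣p∣+∣q∣ p q

  p∩⁅x⁆≡⁅x⁆ : ∀ {n} (p : Subset n) x → lookup p x ≡ true → p ∩ ⁅ x ⁆ ≡ ⁅ x ⁆
  p∩⁅x⁆≡⁅x⁆ (true ∷ p) zero    _   = cong (true ∷_) (SubP.∩-zeroʳ p)
  p∩⁅x⁆≡⁅x⁆ (b ∷ p)    (suc x) x∈p = cong₂ _∷_ (BoolP.∧-zeroʳ b) (p∩⁅x⁆≡⁅x⁆ p x x∈p)

  ∣S∪X∣≤m : ∀ {n m t} (S X : Subset n) → ∣ X ∣ ℕ.≤ t → ∣ S ∣ ℕ.+ t ≡ m → ∣ S ∪ X ∣ ℕ.≤ m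
  ∣S∪X∣≤m S X ∣X∣≤t ∣S∣+t≡m =
    ℕP.≤-trans (∣p∪q∣≤∣p∣+∣q∣ S X)
               (subst (∣ S ∣ ℕ.+ ∣ X ∣ ℕ.≤_) ∣S∣+t≡m (ℕP.+-monoʳ-≤ ∣ S ∣ ∣X∣≤t))

  ∣S∪⁅j⁆∣≤m : ∀ {n m t} (S : Subset n) → 1 ℕ.≤ t → ∣ S ∣ ℕ.+ t ≡ m → ∀ j → ∣ S ∪ ⁅ j ⁆ ∣ ℕ.≤ m
  ∣S∪⁅j⁆∣≤m S 1≤t ∣S∣+t≡m j =
    ∣S∪X∣≤m S ⁅ j ⁆ (subst (ℕ._≤ _) (sym (SubP.∣⁅x⁆∣≡1 j)) 1≤t) ∣S∣+t≡m

  1≤m : ∀ {m t s} → 1 ℕ.≤ t → s ℕ.+ t ≡ m → 1 ℕ.≤ m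
  1≤m {t = t} {s} 1≤t s+t≡m = subst (1 ℕ.≤_) s+t≡m (ℕP.≤-trans 1≤t (ℕP.m≤n+m t s))

  -- Assignments

  module _ {k : ℕ} where

    HasDomain : ∀ {n} → Subset n → PA n k → Set
    HasDomain []          []            = Unit
    HasDomain (true ∷ T)  (nothing ∷ x) = ⊥
    HasDomain (true ∷ T)  (just _ ∷ x)  = HasDomain T x
    HasDomain (false ∷ T) (nothing ∷ x) = HasDomain T x
    HasDomain (false ∷ T) (just _ ∷ x)  = ⊥

    ∈asgs⇒HasDomain : ∀ {n} (T : Subset n) {x : PA n k} → x ∈ asgs k T → HasDomain T x
    ∈asgs⇒HasDomain []          {[]} _  = tt
    ∈asgs⇒HasDomain (true ∷ T)  x∈
      with a , x∈a ← satisfied (∈-concatMap⁻ (λ a → map (just a ∷_) (asgs k T)) {xs = allFin k} x∈)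
      with y , y∈ , refl ← ∈-map⁻ (just a ∷_) x∈a = ∈asgs⇒HasDomain T y∈
    ∈asgs⇒HasDomain (false ∷ T) x∈
      with y , y∈ , refl ← ∈-map⁻ (nothing ∷_) x∈ = ∈asgs⇒HasDomain T y∈

    HasDomain⇒∈asgs : ∀ {n} (T : Subset n) (x : PA n k) → HasDomain T x → x ∈ asgs k T
    HasDomain⇒∈asgs []          []            _ = here refl
    HasDomain⇒∈asgs (true ∷ T)  (just a ∷ x)  x∶T =
      ∈-concatMap⁺ (λ a → map (just a ∷_) (asgs k T)) {xs = allFin k}
        (Any.map (λ { refl → ∈-map⁺ (just a ∷_) (HasDomain⇒∈asgs T x x∶T) }) (∈-allFin a))
    HasDomain⇒∈asgs (false ∷ T) (nothing ∷ x) x∶T = ∈-map⁺ (nothing ∷_) (HasDomain⇒∈asgs T x x∶T)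

    Σ-asgs-∷-true : ∀ {n} (T : Subset n) (f : PA (suc n) k → ℚ) →
                    Σ[ asgs k (true ∷ T) ] f ≡ Σ[ allFin k ] (λ a → Σ[ asgs k T ] (λ y → f (just a ∷ y)))
    Σ-asgs-∷-true T f =
      trans (Σ-concatMap (λ a → map (just a ∷_) (asgs k T)) (allFin k) f)
            (Σ-cong (allFin k) (λ a → Σ-map (just a ∷_) (asgs k T) f))

    Σ-asgs-∷-false : ∀ {n} (T : Subset n) (f : PA (suc n) k → ℚ) →
                     Σ[ asgs k (false ∷ T) ] f ≡ Σ[ asgs k T ] (λ y → f (nothing ∷ y))
    Σ-asgs-∷-false T f = Σ-map (nothing ∷_) (asgs k T) f

    Σ-asgs-δ : ∀ {n} (S : Subset n) (w : PA n k) → HasDomain S w → (c : PA n k → ℚ) →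
               Σ[ asgs k S ] (λ y → mask (does (w ≟PA y)) (c y)) ≡ c w
    Σ-asgs-δ []          []            _   c = ℚP.+-identityʳ (c [])
    Σ-asgs-δ (true ∷ S)  (just b ∷ w)  w∶S c = begin
        Σ[ asgs k (true ∷ S) ] (λ y → mask (does ((just b ∷ w) ≟PA y)) (c y))
      ≡⟨ Σ-asgs-∷-true S (λ y → mask (does ((just b ∷ w) ≟PA y)) (c y)) ⟩
        Σ[ allFin k ] (λ a → Σ[ asgs k S ] (λ y → mask (does (b Fin.≟ a) ∧ does (w ≟PA y)) (c (just a ∷ y))))
      ≡⟨ Σ-cong (allFin k) (λ a → trans (Σ-cong (asgs k S) (λ y → mask-∧ (does (b Fin.≟ a)) _ _))
                                        (Σ-mask (asgs k S) (does (b Fin.≟ a)) _)) ⟩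
        Σ[ allFin k ] (λ a → mask (does (b Fin.≟ a)) (Σ[ asgs k S ] (λ y → mask (does (w ≟PA y)) (c (just a ∷ y)))))
      ≡⟨ Σ-allFin-δ b _ ⟩
        Σ[ asgs k S ] (λ y → mask (does (w ≟PA y)) (c (just b ∷ y)))
      ≡⟨ Σ-asgs-δ S w w∶S (c ∘ (just b ∷_)) ⟩
        c (just b ∷ w) ∎
      where open ≡-Reasoning
    Σ-asgs-δ (false ∷ S) (nothing ∷ w) w∶S c =
      trans (Σ-asgs-∷-false S (λ y → mask (does ((nothing ∷ w) ≟PA y)) (c y))) (Σ-asgs-δ S w w∶S (c ∘ (nothing ∷_)))

    HasDomain⇒restr≡id : ∀ {n} (S : Subset n) (y : PA n k) → HasDomain S y → restr S y ≡ y
    HasDomain⇒restr≡id []          []            _   = refl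
    HasDomain⇒restr≡id (true ∷ S)  (just a ∷ y)  y∶S = cong (just a ∷_) (HasDomain⇒restr≡id S y y∶S)
    HasDomain⇒restr≡id (false ∷ S) (nothing ∷ y) y∶S = cong (nothing ∷_) (HasDomain⇒restr≡id S y y∶S)

    Σ-asgs-restr-δ : ∀ {n} (S : Subset n) (w : PA n k) → HasDomain S w → (c : PA n k → ℚ) →
                     Σ[ asgs k S ] (λ y → mask (does (restr S y ≟PA w)) (c y)) ≡ c w
    Σ-asgs-restr-δ S w w∶S c = trans (Σ-cong-∈ (asgs k S) restr-y≟w≡w≟y) (Σ-asgs-δ S w w∶S c)
      where
      restr-y≟w≡w≟y : ∀ y → y ∈ asgs k S → mask (does (restr S y ≟PA w)) (c y) ≡ mask (does (w ≟PA y)) (c y)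
      restr-y≟w≡w≟y y y∈ = cong (λ b → mask b (c y))
        (trans (cong (λ z → does (z ≟PA w)) (HasDomain⇒restr≡id S y (∈asgs⇒HasDomain S y∈)))
               (does-sym (y ≟PA w) (w ≟PA y)))

    lookup-restr : ∀ {n} (S : Subset n) (x : PA n k) j → lookup (restr S x) j ≡ (if lookup S j then lookup x j else nothing)
    lookup-restr (b ∷ S) (m ∷ x) zero    = refl
    lookup-restr (b ∷ S) (m ∷ x) (suc j) = lookup-restr S x j

    HasDomain-restr : ∀ {n} (T U : Subset n) (z : PA n k) → HasDomain U z →
                      (∀ j → lookup T j ≡ true → lookup U j ≡ true) → HasDomain T (restr T z)
    HasDomain-restr []          []          []            _   _    = tt
    HasDomain-restr (false ∷ T) (true ∷ U)  (just _ ∷ z)  z∶U T⊆U = HasDomain-restr T U z z∶U (T⊆U ∘ suc)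
    HasDomain-restr (false ∷ T) (false ∷ U) (nothing ∷ z) z∶U T⊆U = HasDomain-restr T U z z∶U (T⊆U ∘ suc)
    HasDomain-restr (true ∷ T)  (true ∷ U)  (just _ ∷ z)  z∶U T⊆U = HasDomain-restr T U z z∶U (T⊆U ∘ suc)
    HasDomain-restr (true ∷ T)  (false ∷ U) (nothing ∷ z) z∶U T⊆U with () ← T⊆U zero refl

    HasDomain-∉ : ∀ {n} (S : Subset n) (w : PA n k) j → HasDomain S w → lookup S j ≡ false → lookup w j ≡ nothing
    HasDomain-∉ (false ∷ S) (nothing ∷ w) zero    _   _   = refl
    HasDomain-∉ (true ∷ S)  (just _ ∷ w)  (suc j) w∶S j∉S = HasDomain-∉ S w j w∶S j∉S
    HasDomain-∉ (false ∷ S) (nothing ∷ w) (suc j) w∶S j∉S = HasDomain-∉ S w j w∶S j∉S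

    HasDomain-extend : ∀ {n} (S : Subset n) (w : PA n k) j a → HasDomain S w → lookup S j ≡ false →
                       HasDomain (S ∪ ⁅ j ⁆) (w [ j ]≔ just a)
    HasDomain-extend (false ∷ S) (nothing ∷ w) zero    a w∶S _   rewrite SubP.∪-identityʳ S = w∶S
    HasDomain-extend (true ∷ S)  (just _ ∷ w)  (suc j) a w∶S j∉S = HasDomain-extend S w j a w∶S j∉S
    HasDomain-extend (false ∷ S) (nothing ∷ w) (suc j) a w∶S j∉S = HasDomain-extend S w j a w∶S j∉S

    restr-∪⁅⁆ : ∀ {n} (S : Subset n) (x : PA n k) j → lookup S j ≡ false →
                restr (S ∪ ⁅ j ⁆) x ≡ restr S x [ j ]≔ lookup x j
    restr-∪⁅⁆ (false ∷ S) (m ∷ x) zero    _   rewrite SubP.∪-identityʳ S = refl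
    restr-∪⁅⁆ (true ∷ S)  (m ∷ x) (suc j) j∉S = cong (m ∷_) (restr-∪⁅⁆ S x j j∉S)
    restr-∪⁅⁆ (false ∷ S) (m ∷ x) (suc j) j∉S = cong (nothing ∷_) (restr-∪⁅⁆ S x j j∉S)

    ≟PA-[]≔ : ∀ {n} (u v : PA n k) j m m′ → lookup u j ≡ nothing → lookup v j ≡ nothing →
              does ((u [ j ]≔ m) ≟PA (v [ j ]≔ m′)) ≡ does (u ≟PA v) ∧ does (m ≟M m′)
    ≟PA-[]≔ (_ ∷ u) (_ ∷ v) zero    m m′ refl refl = BoolP.∧-comm (does (m ≟M m′)) (does (u ≟PA v))
    ≟PA-[]≔ (x ∷ u) (y ∷ v) (suc j) m m′ u-j v-j rewrite ≟PA-[]≔ u v j m m′ u-j v-j =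
      sym (BoolP.∧-assoc (does (x ≟M y)) (does (u ≟PA v)) (does (m ≟M m′)))

    Σ-asgs-extension : ∀ {n} (S : Subset n) (xS : PA n k) j → HasDomain S xS → lookup S j ≡ false → (f : PA n k → ℚ) →
                       Σ[ asgs k (S ∪ ⁅ j ⁆) ] (λ z → mask (does (restr S z ≟PA xS)) (f z))
                         ≡ Σ[ allFin k ] (λ a → f (xS [ j ]≔ just a))
    Σ-asgs-extension {suc n} (false ∷ S) (nothing ∷ xS) zero xS∶S _ f rewrite SubP.∪-identityʳ S =
      trans (Σ-asgs-∷-true S F) (Σ-cong (allFin k) (λ a → Σ-asgs-restr-δ S xS xS∶S (f ∘ (just a ∷_))))
      where
      F : PA (suc n) k → ℚ
      F z = mask (does (restr (false ∷ S) z ≟PA (nothing ∷ xS))) (f z)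
    Σ-asgs-extension {suc n} (true ∷ S) (just c ∷ xS) (suc j) xS∶S j∉S f =
      trans (Σ-asgs-∷-true (S ∪ ⁅ j ⁆) F)
        (trans (Σ-cong (allFin k) (λ a →
                  trans (Σ-cong (asgs k (S ∪ ⁅ j ⁆)) (λ y → mask-∧ (does (a Fin.≟ c)) _ (f (just a ∷ y))))
                        (Σ-mask (asgs k (S ∪ ⁅ j ⁆)) (does (a Fin.≟ c)) (G a))))
          (trans (Σ-allFin-δ′ c (λ a → Σ[ asgs k (S ∪ ⁅ j ⁆) ] (G a)))
                 (Σ-asgs-extension S xS j xS∶S j∉S (f ∘ (just c ∷_)))))
      where
      F : PA (suc n) k → ℚ
      F z = mask (does (restr (true ∷ S) z ≟PA (just c ∷ xS))) (f z)
      G : Fin k → PA n k → ℚ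
      G a y = mask (does (restr S y ≟PA xS)) (f (just a ∷ y))
    Σ-asgs-extension {suc n} (false ∷ S) (nothing ∷ xS) (suc j) xS∶S j∉S f =
      trans (Σ-asgs-∷-false (S ∪ ⁅ j ⁆) F) (Σ-asgs-extension S xS j xS∶S j∉S (f ∘ (nothing ∷_)))
      where
      F : PA (suc n) k → ℚ
      F z = mask (does (restr (false ∷ S) z ≟PA (nothing ∷ xS))) (f z)

    Σ-slice-Π∉ : ∀ {n} (S : Subset n) (xS : PA n k) → HasDomain S xS → (h : Fin n → Maybe (Fin k) → ℚ) →
                 Σ[ asgs k ⊤ ] (λ x → mask (does (restr S x ≟PA xS)) (Π[∉ S ] (λ j → h j (lookup x j))))
                   ≡ Π[∉ S ] (λ j → Σ[ allFin k ] (λ b → h j (just b)))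
    Σ-slice-Π∉ []          []             _    h = ℚP.+-identityʳ _
    Σ-slice-Π∉ {suc n} (true ∷ S)  (just c ∷ xS)  xS∶S h =
      trans (Σ-asgs-∷-true ⊤ F)
        (trans (Σ-cong (allFin k) (λ a →
                  trans (Σ-cong (asgs k ⊤) (λ y → mask-∧ (does (a Fin.≟ c)) _ (Πh y)))
                        (Σ-mask (asgs k ⊤) (does (a Fin.≟ c)) G)))
          (trans (Σ-allFin-δ′ c (λ _ → Σ[ asgs k ⊤ ] G))
                 (Σ-slice-Π∉ S xS xS∶S (h ∘ suc))))
      where
      F : PA (suc n) k → ℚ
      F x = mask (does (restr (true ∷ S) x ≟PA (just c ∷ xS))) (Π[∉ true ∷ S ] (λ j → h j (lookup x j)))
      Πh G : PA n k → ℚ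
      Πh y = Π[∉ S ] (λ j → h (suc j) (lookup y j))
      G y = mask (does (restr S y ≟PA xS)) (Πh y)
    Σ-slice-Π∉ {suc n} (false ∷ S) (nothing ∷ xS) xS∶S h =
      trans (Σ-asgs-∷-true ⊤ F)
        (trans (Σ-cong (allFin k) (λ a →
                  trans (Σ-cong (asgs k ⊤) (λ y → sym (mask-*ʳ (does (restr S y ≟PA xS)) (h zero (just a)) (Πh y))))
                        (trans (Σ-*ˡ (asgs k ⊤) (h zero (just a)) G)
                               (cong (h zero (just a) *_) (Σ-slice-Π∉ S xS xS∶S (h ∘ suc))))))
          (Σ-*ʳ (allFin k) (Π[∉ S ] (λ j → Σ[ allFin k ] (λ b → h (suc j) (just b)))) (λ a → h zero (just a))))
      where
      F : PA (suc n) k → ℚ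
      F x = mask (does (restr (false ∷ S) x ≟PA (nothing ∷ xS))) (Π[∉ false ∷ S ] (λ j → h j (lookup x j)))
      Πh G : PA n k → ℚ
      Πh y = Π[∉ S ] (λ j → h (suc j) (lookup y j))
      G y = mask (does (restr S y ≟PA xS)) (Πh y)

    Σ-fibres : ∀ {n} {Ω : Set} (T : Subset n) (xs : List Ω) (π : Ω → PA n k) (c : PA n k → Ω → ℚ) →
               (∀ ω → ω ∈ xs → HasDomain T (π ω)) →
               Σ[ asgs k T ] (λ y → Σ[ xs ] (λ ω → mask (does (π ω ≟PA y)) (c y ω))) ≡ Σ[ xs ] (λ ω → c (π ω) ω)
    Σ-fibres T xs π c π∶T =
      trans (Σ-swap (asgs k T) xs (λ y ω → mask (does (π ω ≟PA y)) (c y ω)))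
            (Σ-cong-∈ xs (λ ω ω∈ → Σ-asgs-δ T (π ω) (π∶T ω ω∈) (λ y → c y ω)))

    ≟M-refl : ∀ (m : Maybe (Fin k)) → does (m ≟M m) ≡ true
    ≟M-refl m with m ≟M m
    ... | yes _  = refl
    ... | no m≢m = ⊥-elim (m≢m refl)

    restr-≢-union-bound : ∀ {n} (T S : Subset n) (x c : PA n k) {w : ℚ} → 0ℚ ≤ w →
                          (∀ j → lookup S j ≡ true → lookup x j ≡ lookup c j) →
                          mask (not (does (restr T x ≟PA restr T c))) w
                            ≤ Σ[∈ T ─ S ] (λ j → mask (not (does (lookup x j ≟M lookup c j))) w)
    restr-≢-union-bound []          []          []       []       0≤w _   = ℚP.≤-refl
    restr-≢-union-bound (false ∷ T) (true ∷ S)  (_ ∷ x)  (_ ∷ c)  0≤w x=c = restr-≢-union-bound T S x c 0≤w (x=c ∘ suc)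
    restr-≢-union-bound (false ∷ T) (false ∷ S) (_ ∷ x)  (_ ∷ c)  0≤w x=c = restr-≢-union-bound T S x c 0≤w (x=c ∘ suc)
    restr-≢-union-bound (true ∷ T)  (true ∷ S)  (xm ∷ x) (cm ∷ c) 0≤w x=c
      rewrite x=c zero refl | ≟M-refl cm = restr-≢-union-bound T S x c 0≤w (x=c ∘ suc)
    restr-≢-union-bound (true ∷ T)  (false ∷ S) (xm ∷ x) (cm ∷ c) {w} 0≤w x=c with does (xm ≟M cm)
    ... | true  = ℚP.≤-trans (restr-≢-union-bound T S x c 0≤w (x=c ∘ suc)) (ℚP.≤-reflexive (sym (ℚP.+-identityˡ _)))
    ... | false = ℚP.≤-trans (ℚP.≤-reflexive (sym (ℚP.+-identityʳ w)))
                    (ℚP.+-monoʳ-≤ w (Σ∈-nonneg (T ─ S) (λ j _ → mask-nonneg (not (does (lookup x j ≟M lookup c j))) 0≤w)))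

    marg-as-Σ : ∀ {n} (W W′ : Subset n) (p : PA n k → ℚ) y →
                marg k W W′ p y ≡ Σ[ asgs k W ] (λ x → mask (does (restr W′ x ≟PA y)) (p x))
    marg-as-Σ W W′ p y = Σ-filter (λ x → restr W′ x ≟PA y) (asgs k W) p

    marg-self : ∀ {n} (W : Subset n) (p : PA n k → ℚ) y → HasDomain W y → marg k W W p y ≡ p y
    marg-self W p y y∶W = trans (marg-as-Σ W W p y) (Σ-asgs-restr-δ W y y∶W p)

    Σ-by-slices : ∀ {n} {Ω : Set} (S : Subset n) (xs : List Ω) (π : Ω → PA n k) → (∀ ω → ω ∈ xs → HasDomain S (π ω)) →
                  (f : Ω → ℚ) → Σ[ xs ] f ≡ Σ[ asgs k S ] (λ xS → Σ[ xs ] (λ ω → mask (does (π ω ≟PA xS)) (f ω)))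
    Σ-by-slices S xs π π∶S f = sym (Σ-fibres S xs π (λ _ → f) π∶S)

    Prob-pushforward : ∀ {n} {Ω : Set} (T : Subset n) (xs : List Ω) (w : Ω → ℚ) (p : PA n k → ℚ) (π : Ω → PA n k) →
                       (∀ ω → ω ∈ xs → HasDomain T (π ω)) →
                       (∀ y → y ∈ asgs k T → p y ≡ Σ[ xs ] (λ ω → mask (does (π ω ≟PA y)) (w ω))) →
                       ∀ A → Prob k T p A ≡ Σ[ xs ] (λ ω → mask (A (π ω)) (w ω))
    Prob-pushforward T xs w p π π∶T p≡ A = begin
        Prob k T p A
      ≡⟨ Σ-filter (λ y → A y ≟B true) (asgs k T) p ⟩
        Σ[ asgs k T ] (λ y → mask (does (A y ≟B true)) (p y))
      ≡⟨ Σ-cong-∈ (asgs k T) (λ y y∈ → cong₂ mask (does-≟true (A y)) (p≡ y y∈)) ⟩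
        Σ[ asgs k T ] (λ y → mask (A y) (Σ[ xs ] (λ ω → mask (does (π ω ≟PA y)) (w ω))))
      ≡⟨ Σ-cong (asgs k T) (λ y → trans (sym (Σ-mask xs (A y) _))
                                         (Σ-cong xs (λ ω → mask-comm (A y) (does (π ω ≟PA y)) (w ω)))) ⟩
        Σ[ asgs k T ] (λ y → Σ[ xs ] (λ ω → mask (does (π ω ≟PA y)) (mask (A y) (w ω))))
      ≡⟨ Σ-fibres T xs π (λ y ω → mask (A y) (w ω)) π∶T ⟩
        Σ[ xs ] (λ ω → mask (A (π ω)) (w ω)) ∎
      where
      open ≡-Reasoning
      does-≟true : ∀ b → does (b ≟B true) ≡ b
      does-≟true true  = refl
      does-≟true false = refl

  asgs-0 : ∀ {n} (W : Subset n) j → lookup W j ≡ true → asgs 0 W ≡ []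
  asgs-0 (true ∷ W)  zero    _   = refl
  asgs-0 (true ∷ W)  (suc j) _   = refl
  asgs-0 (false ∷ W) (suc j) j∈W = cong (map (nothing ∷_)) (asgs-0 W j j∈W)

  -- Slices of a weighted list

  module _ {Ω : Set} {n k : ℕ} (xs : List Ω) (w : Ω → ℚ) (σ : Ω → PA n k) (xS : PA n k) where

    slice-mass : (Ω → Bool) → ℚ
    slice-mass E = Σ[ xs ] (λ ω → mask (does (σ ω ≟PA xS)) (mask (E ω) (w ω)))

    slice-mass∈Window : (∀ ω → ω ∈ xs → 0ℚ ≤ w ω) → ∀ (π : Ω → PA n k) g A {D d} →
                        slice-mass (λ _ → true) ≡ D → slice-mass (λ ω → not (does (π ω ≟PA g))) ≤ d →
                        Window (A g) D d (slice-mass (A ∘ π))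
    slice-mass∈Window 0≤w π g A {D} {d} mass≡D off≤d = window (A g) refl
      where
      off : Ω → ℚ
      off ω = mask (not (does (π ω ≟PA g))) (w ω)
      on-slice : ∀ {f h : Ω → ℚ} → (∀ ω → 0ℚ ≤ w ω → f ω ≤ h ω) →
                 Σ[ xs ] (λ ω → mask (does (σ ω ≟PA xS)) (f ω)) ≤ Σ[ xs ] (λ ω → mask (does (σ ω ≟PA xS)) (h ω))
      on-slice f≤h = Σ-mono-∈ xs (λ ω ω∈ → mask-mono (does (σ ω ≟PA xS)) (f≤h ω (0≤w ω ω∈)))
      event≤D : slice-mass (A ∘ π) ≤ D
      event≤D = subst (slice-mass (A ∘ π) ≤_) mass≡D (on-slice (λ ω → mask-≤ (A (π ω))))
      window : ∀ b → A g ≡ b → Window b D d (slice-mass (A ∘ π))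
      window true  Ag = ℚP.≤-trans (ℚP.+-monoʳ-≤ D (ℚP.neg-antimono-≤ off≤d))
                          (subst (λ D → D - slice-mass (λ ω → not (does (π ω ≟PA g))) ≤ slice-mass (A ∘ π)) mass≡D
                            (subst (_≤ slice-mass (A ∘ π)) mass-off≡ (on-slice off-or-in-A)))
                      , event≤D
        where
        mass-off≡ : Σ[ xs ] (λ ω → mask (does (σ ω ≟PA xS)) (w ω - off ω))
                      ≡ slice-mass (λ _ → true) - slice-mass (λ ω → not (does (π ω ≟PA g)))
        mass-off≡ = trans (Σ-cong xs (λ ω → mask-distrib-- (does (σ ω ≟PA xS)) (w ω) (off ω)))
                          (Σ-- xs (λ ω → mask (does (σ ω ≟PA xS)) (w ω)) (λ ω → mask (does (σ ω ≟PA xS)) (off ω)))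
        off-or-in-A : ∀ ω → 0ℚ ≤ w ω → w ω - off ω ≤ mask (A (π ω)) (w ω)
        off-or-in-A ω 0≤wω with π ω ≟PA g
        ... | yes refl rewrite Ag = ℚP.≤-reflexive (ℚP.+-identityʳ (w ω))
        ... | no _ = ℚP.≤-trans (ℚP.≤-reflexive (ℚP.+-inverseʳ (w ω))) (mask-nonneg (A (π ω)) 0≤wω)
      window false Ag = Σ-nonneg xs (λ ω ω∈ → mask-nonneg (does (σ ω ≟PA xS)) (mask-nonneg (A (π ω)) (0≤w ω ω∈)))
                      , ℚP.≤-trans (on-slice in-A⇒off) off≤d
        where
        in-A⇒off : ∀ ω → 0ℚ ≤ w ω → mask (A (π ω)) (w ω) ≤ off ω
        in-A⇒off ω 0≤wω with π ω ≟PA g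
        ... | yes refl rewrite Ag = ℚP.≤-refl
        ... | no _ = mask-≤ (A (π ω)) 0≤wω

  -- Propagation rounding

  value-exists : ∀ {n k m} → LocalDists n k m → 1 ℕ.≤ m → Fin n → Fin k
  value-exists {k = suc k} _ _   _ = zero
  value-exists {k = zero}  L 1≤m j = ⊥-elim (0≢1 (trans (cong (Σ[_] μ ⁅ j ⁆) (sym (asgs-0 ⁅ j ⁆ j j∈⁅j⁆)))
                                                       (proj₂ (isDist ⁅ j ⁆ (subst (ℕ._≤ _) (sym (SubP.∣⁅x⁆∣≡1 j)) 1≤m)))))
    where
    open LocalDists L
    j∈⁅j⁆ : lookup ⁅ j ⁆ j ≡ true
    j∈⁅j⁆ = VecP.[]=⇒lookup (SubP.x∈⁅x⁆ j)
    0≢1 : 0ℚ ≢ 1ℚ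
    0≢1 ()

  module PropagationRounding {n k m : ℕ} (L : LocalDists n k m) (S T : Subset n)
           (∣S∪T∣≤m : ∣ S ∪ T ∣ ℕ.≤ m) (∣S∪j∣≤m : ∀ j → ∣ S ∪ ⁅ j ⁆ ∣ ℕ.≤ m)
           (anyValue : Fin n → Fin k) where
    -- anyValue only seeds the argmax that defines the mode (see value-exists).

    open LocalDists L

    U : Subset n
    U = S ∪ T

    Ω : List (PA n k)
    Ω = asgs k ⊤

    ν : PA n k → ℚ
    ν = propRound L S

    ∣S∣≤m : ∣ S ∣ ℕ.≤ m
    ∣S∣≤m = ℕP.≤-trans (SubP.∣p∣≤∣p∪q∣ S T) ∣S∪T∣≤m

    ∣T∣≤m : ∣ T ∣ ℕ.≤ m
    ∣T∣≤m = ℕP.≤-trans (SubP.∣q∣≤∣p∪q∣ S T) ∣S∪T∣≤m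

    μ-nonneg : ∀ W → ∣ W ∣ ℕ.≤ m → ∀ y → y ∈ asgs k W → 0ℚ ≤ μ W y
    μ-nonneg W ∣W∣≤m = proj₁ (isDist W ∣W∣≤m)

    marg-μ : ∀ W W′ → ∣ W ∣ ℕ.≤ m → ∣ W′ ∣ ℕ.≤ m → W ∩ W′ ≡ W′ → ∀ y → HasDomain W′ y →
             marg k W W′ (μ W) y ≡ μ W′ y
    marg-μ W W′ ∣W∣≤m ∣W′∣≤m W∩W′≡W′ y y∶W′ =
      trans (subst (λ V → marg k W V (μ W) y ≡ marg k W′ V (μ W′) y) W∩W′≡W′
                   (consistent W W′ ∣W∣≤m ∣W′∣≤m y
                      (subst (λ V → y ∈ asgs k V) (sym W∩W′≡W′) (HasDomain⇒∈asgs W′ y y∶W′))))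
            (marg-self W′ (μ W′) y y∶W′)

    S∪X∩S≡S : ∀ X → (S ∪ X) ∩ S ≡ S
    S∪X∩S≡S X = trans (SubP.∩-comm (S ∪ X) S) (SubP.∩-abs-∪ S X)

    restr-HasDomain : ∀ W {x} → x ∈ Ω → HasDomain W (restr W x)
    restr-HasDomain W {x} x∈ = HasDomain-restr W ⊤ x (∈asgs⇒HasDomain ⊤ x∈) (λ j _ → VecP.lookup-replicate j true)

    restr-HasDomainᵁ : ∀ W → (∀ j → lookup W j ≡ true → lookup U j ≡ true) → ∀ {z} → z ∈ asgs k U → HasDomain W (restr W z)
    restr-HasDomainᵁ W W⊆U {z} z∈ = HasDomain-restr W U z (∈asgs⇒HasDomain U z∈) W⊆U

    joint : Fin n → PA n k → Fin k → ℚ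
    joint j xS a = μ (S ∪ ⁅ j ⁆) (xS [ j ]≔ just a)

    seedMarg : Fin n → PA n k → ℚ
    seedMarg j = marg k (S ∪ ⁅ j ⁆) S (μ (S ∪ ⁅ j ⁆))

    seedMarg≡μS : ∀ j xS → HasDomain S xS → seedMarg j xS ≡ μ S xS
    seedMarg≡μS j = marg-μ (S ∪ ⁅ j ⁆) S (∣S∪j∣≤m j) ∣S∣≤m (S∪X∩S≡S ⁅ j ⁆)

    seedMarg-nonneg : ∀ j xS → 0ℚ ≤ seedMarg j xS
    seedMarg-nonneg j xS = subst (0ℚ ≤_) (sym (marg-as-Σ (S ∪ ⁅ j ⁆) S (μ (S ∪ ⁅ j ⁆)) xS))
      (Σ-nonneg (asgs k (S ∪ ⁅ j ⁆)) (λ z z∈ →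
         mask-nonneg (does (restr S z ≟PA xS)) (μ-nonneg (S ∪ ⁅ j ⁆) (∣S∪j∣≤m j) z z∈)))

    cond : PA n k → Fin n → Maybe (Fin k) → ℚ
    cond xS i w = μ (S ∪ ⁅ i ⁆) (xS [ i ]≔ w) ÷₀ seedMarg i xS

    ν-on-slice : ∀ x xS → restr S x ≡ xS → ν x ≡ μ S xS * Π[∉ S ] (λ i → cond xS i (lookup x i))
    ν-on-slice x _ refl = cong (μ S (restr S x) *_)
      (trans (Π-filter-∉ S (λ i → condProb L S i x))
             (Π∉-cong S (λ i i∉S →
                cong (λ z → μ (S ∪ ⁅ i ⁆) z ÷₀ seedMarg i (restr S x)) (restr-∪⁅⁆ S x i i∉S))))

    μU-nonneg : ∀ z → z ∈ asgs k U → 0ℚ ≤ μ U z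
    μU-nonneg = μ-nonneg U ∣S∪T∣≤m

    ν-nonneg : ∀ x → x ∈ Ω → 0ℚ ≤ ν x
    ν-nonneg x x∈ =
      *-nonneg (μ-nonneg S ∣S∣≤m (restr S x) (HasDomain⇒∈asgs S (restr S x) (restr-HasDomain S x∈)))
        (subst (0ℚ ≤_) (sym (Π-filter-∉ S (λ i → condProb L S i x)))
          (Π∉-nonneg S (λ i → condProb L S i x) (λ i _ →
            ÷₀-nonneg (μ-nonneg (S ∪ ⁅ i ⁆) (∣S∪j∣≤m i) (restr (S ∪ ⁅ i ⁆) x)
                                 (HasDomain⇒∈asgs (S ∪ ⁅ i ⁆) _ (restr-HasDomain (S ∪ ⁅ i ⁆) x∈)))
                      (seedMarg-nonneg i (restr S x)))))

    mode : PA n k → Fin n → Fin k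
    mode xS j = argmax (joint j xS) (anyValue j) (allFin k)

    joint≤mode : ∀ xS j a → joint j xS a ≤ joint j xS (mode xS j)
    joint≤mode xS j a = All.lookup (f[xs]≤f[argmax] (anyValue j) (allFin k)) (∈-allFin a)

    modeAssignment : PA n k → PA n k
    modeAssignment xS = tabulate (λ j → if lookup S j then lookup xS j else just (mode xS j))

    -- Bounds, under μ U and ν alike, the mass of the slice X_S = xS that disagrees with modeAssignment xS on T.
    deficit : PA n k → ℚ
    deficit xS = Σ[∈ T ─ S ] (λ j → μ S xS - joint j xS (mode xS j))

    Prob-μT≡Σ-slices : ∀ A → Prob k T (μ T) A ≡ Σ[ asgs k S ] (λ xS → slice-mass (asgs k U) (μ U) (restr S) xS (A ∘ restr T))
    Prob-μT≡Σ-slices A =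
      trans (Prob-pushforward T (asgs k U) (μ U) (μ T) (restr T) (λ _ → restr-HasDomainᵁ T T⊆U) μT≡marg A)
            (Σ-by-slices S (asgs k U) (restr S) (λ _ → restr-HasDomainᵁ S S⊆U) (λ z → mask (A (restr T z)) (μ U z)))
      where
      S⊆U : ∀ j → lookup S j ≡ true → lookup U j ≡ true
      S⊆U j j∈S = trans (VecP.lookup-zipWith _∨_ j S T) (cong (_∨ lookup T j) j∈S)
      T⊆U : ∀ j → lookup T j ≡ true → lookup U j ≡ true
      T⊆U j j∈T = trans (VecP.lookup-zipWith _∨_ j S T) (trans (cong (lookup S j ∨_) j∈T) (BoolP.∨-zeroʳ _))
      U∩T≡T : U ∩ T ≡ T
      U∩T≡T = trans (SubP.∩-comm U T) (trans (cong (T ∩_) (SubP.∪-comm S T)) (SubP.∩-abs-∪ T S))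
      μT≡marg : ∀ y → y ∈ asgs k T → μ T y ≡ Σ[ asgs k U ] (λ z → mask (does (restr T z ≟PA y)) (μ U z))
      μT≡marg y y∈ = trans (sym (marg-μ U T ∣S∪T∣≤m ∣T∣≤m U∩T≡T y (∈asgs⇒HasDomain T y∈))) (marg-as-Σ U T (μ U) y)

    Prob-ν≡Σ-slices : ∀ A → Prob k T (propRoundMarg L S T) A ≡ Σ[ asgs k S ] (λ xS → slice-mass Ω ν (restr S) xS (A ∘ restr T))
    Prob-ν≡Σ-slices A =
      trans (Prob-pushforward T Ω ν (propRoundMarg L S T) (restr T) (λ _ → restr-HasDomain T) (λ y _ → marg-as-Σ ⊤ T ν y) A)
            (Σ-by-slices S Ω (restr S) (λ _ → restr-HasDomain S) (λ x → mask (A (restr T x)) (ν x)))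

    module _ (xS : PA n k) (xS∶S : HasDomain S xS) where

      Σjoint≡seedMarg : ∀ j → lookup S j ≡ false → Σ[ allFin k ] (joint j xS) ≡ seedMarg j xS
      Σjoint≡seedMarg j j∉S =
        sym (trans (marg-as-Σ (S ∪ ⁅ j ⁆) S (μ (S ∪ ⁅ j ⁆)) xS) (Σ-asgs-extension S xS j xS∶S j∉S (μ (S ∪ ⁅ j ⁆))))

      Σjoint≡μS : ∀ j → lookup S j ≡ false → Σ[ allFin k ] (joint j xS) ≡ μ S xS
      Σjoint≡μS j j∉S = trans (Σjoint≡seedMarg j j∉S) (seedMarg≡μS j xS xS∶S)

      joint-nonneg : ∀ j → lookup S j ≡ false → ∀ a → 0ℚ ≤ joint j xS a
      joint-nonneg j j∉S a =
        μ-nonneg (S ∪ ⁅ j ⁆) (∣S∪j∣≤m j) _ (HasDomain⇒∈asgs (S ∪ ⁅ j ⁆) _ (HasDomain-extend S xS j a xS∶S j∉S))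

      μS≡0⇒joint≡0 : ∀ j → lookup S j ≡ false → ∀ a → μ S xS ≡ 0ℚ → joint j xS a ≡ 0ℚ
      μS≡0⇒joint≡0 j j∉S a μS≡0 = ℚP.≤-antisym
        (ℚP.≤-trans (term≤Σ (allFin k) (joint j xS) (∈-allFin a) (joint-nonneg j j∉S))
                    (ℚP.≤-reflexive (trans (Σjoint≡μS j j∉S) μS≡0)))
        (joint-nonneg j j∉S a)

      Σcond≡1 : μ S xS ≢ 0ℚ → ∀ i → lookup S i ≡ false → Σ[ allFin k ] (λ b → cond xS i (just b)) ≡ 1ℚ
      Σcond≡1 μS≢0 i i∉S =
        trans (Σ-÷₀ (allFin k) (joint i xS) (seedMarg i xS))
          (trans (cong (_÷₀ seedMarg i xS) (Σjoint≡seedMarg i i∉S))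
                 (÷₀-self (seedMarg i xS) (μS≢0 ∘ trans (sym (seedMarg≡μS i xS xS∶S)))))

      Σ-slice-ν-product : ∀ (F : PA n k → ℚ) (h : Fin n → Maybe (Fin k) → ℚ) →
                          (∀ x → restr S x ≡ xS → F x ≡ μ S xS * Π[∉ S ] (λ i → h i (lookup x i))) →
                          Σ[ Ω ] (λ x → mask (does (restr S x ≟PA xS)) (F x))
                            ≡ μ S xS * Π[∉ S ] (λ i → Σ[ allFin k ] (λ b → h i (just b)))
      Σ-slice-ν-product F h F≡ =
        trans (Σ-cong Ω (λ x → mask-does-cong (restr S x ≟PA xS) (F≡ x)))
          (trans (Σ-cong Ω (λ x → sym (mask-*ʳ (does (restr S x ≟PA xS)) (μ S xS) (Πh x))))
            (trans (Σ-*ˡ Ω (μ S xS) (λ x → mask (does (restr S x ≟PA xS)) (Πh x)))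
                   (cong (μ S xS *_) (Σ-slice-Π∉ S xS xS∶S h))))
        where
        Πh : PA n k → ℚ
        Πh x = Π[∉ S ] (λ i → h i (lookup x i))

      ν-slice-mass : Σ[ Ω ] (λ x → mask (does (restr S x ≟PA xS)) (ν x)) ≡ μ S xS
      ν-slice-mass =
        trans (Σ-slice-ν-product ν (cond xS) (λ x restr≡ → ν-on-slice x xS restr≡)) (by-cases (μ S xS ℚP.≟ 0ℚ))
        where
        Πcond : ℚ
        Πcond = Π[∉ S ] (λ i → Σ[ allFin k ] (λ b → cond xS i (just b)))
        by-cases : Dec (μ S xS ≡ 0ℚ) → μ S xS * Πcond ≡ μ S xS
        by-cases (yes μS≡0) = trans (cong (_* Πcond) μS≡0) (trans (ℚP.*-zeroˡ Πcond) (sym μS≡0))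
        by-cases (no  μS≢0) = trans (cong (μ S xS *_) (Π∉-≡1 S _ (Σcond≡1 μS≢0))) (ℚP.*-identityʳ (μ S xS))

      -- the factors of ν on the slice, with that of variable j restricted to X_j = a
      cond-at : Fin n → Fin k → Fin n → Maybe (Fin k) → ℚ
      cond-at j a i w = if does (i Fin.≟ j) then mask (does (w ≟M just a)) 1ℚ * cond xS i w else cond xS i w

      ν-at-value : ∀ j → lookup S j ≡ false → ∀ a x → restr S x ≡ xS →
                   mask (does (lookup x j ≟M just a)) (ν x) ≡ μ S xS * Π[∉ S ] (λ i → cond-at j a i (lookup x i))
      ν-at-value j j∉S a x restr≡ = begin
          mask xj=a (ν x)
        ≡⟨ cong (mask xj=a) (ν-on-slice x xS restr≡) ⟩
          mask xj=a (μ S xS * Πcond)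
        ≡⟨ sym (trans (cong (μ S xS *_) (trans (mask-*ˡ xj=a 1ℚ Πcond) (cong (mask xj=a) (ℚP.*-identityˡ Πcond))))
                      (mask-*ʳ xj=a (μ S xS) Πcond)) ⟩
          μ S xS * (mask xj=a 1ℚ * Πcond)
        ≡⟨ cong (μ S xS *_) (trans (Π∉-scale S (λ i → cond xS i (lookup x i)) j (mask xj=a 1ℚ) j∉S)
                                   (Π∉-cong S (λ i _ → scaled≡cond-at i))) ⟩
          μ S xS * Π[∉ S ] (λ i → cond-at j a i (lookup x i)) ∎
        where
        open ≡-Reasoning
        xj=a : Bool
        xj=a = does (lookup x j ≟M just a)
        Πcond : ℚ
        Πcond = Π[∉ S ] (λ i → cond xS i (lookup x i))
        scaled≡cond-at : ∀ i → (if does (i Fin.≟ j) then mask xj=a 1ℚ * cond xS i (lookup x i) else cond xS i (lookup x i))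
                               ≡ cond-at j a i (lookup x i)
        scaled≡cond-at i with i Fin.≟ j
        ... | yes refl = refl
        ... | no  _    = refl

      Σcond-at-j : ∀ j a → Σ[ allFin k ] (λ b → cond-at j a j (just b)) ≡ cond xS j (just a)
      Σcond-at-j j a with j Fin.≟ j
      ... | yes _   = trans (Σ-cong (allFin k) (λ b → trans (mask-*ˡ (does (b Fin.≟ a)) 1ℚ (cond xS j (just b)))
                                                            (cong (mask (does (b Fin.≟ a))) (ℚP.*-identityˡ _))))
                            (Σ-allFin-δ′ a (λ b → cond xS j (just b)))
      ... | no  j≢j = ⊥-elim (j≢j refl)

      Σcond-at-off-j : μ S xS ≢ 0ℚ → ∀ j a i → lookup S i ≡ false → i ≢ j →
                       Σ[ allFin k ] (λ b → cond-at j a i (just b)) ≡ 1ℚ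
      Σcond-at-off-j μS≢0 j a i i∉S i≢j with i Fin.≟ j
      ... | yes i≡j = ⊥-elim (i≢j i≡j)
      ... | no  _   = Σcond≡1 μS≢0 i i∉S

      ν-slice-joint : ∀ j → lookup S j ≡ false → ∀ a →
                      Σ[ Ω ] (λ x → mask (does (restr S x ≟PA xS)) (mask (does (lookup x j ≟M just a)) (ν x))) ≡ joint j xS a
      ν-slice-joint j j∉S a =
        trans (Σ-slice-ν-product (λ x → mask (does (lookup x j ≟M just a)) (ν x)) (cond-at j a) (ν-at-value j j∉S a))
              (by-cases (μ S xS ℚP.≟ 0ℚ))
        where
        Πcond-at : ℚ
        Πcond-at = Π[∉ S ] (λ i → Σ[ allFin k ] (λ b → cond-at j a i (just b)))
        by-cases : Dec (μ S xS ≡ 0ℚ) → μ S xS * Πcond-at ≡ joint j xS a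
        by-cases (yes μS≡0) =
          trans (cong (_* Πcond-at) μS≡0) (trans (ℚP.*-zeroˡ Πcond-at) (sym (μS≡0⇒joint≡0 j j∉S a μS≡0)))
        by-cases (no  μS≢0) = begin
            μ S xS * Πcond-at
          ≡⟨ cong (μ S xS *_) (trans (Π∉-single S _ j j∉S (Σcond-at-off-j μS≢0 j a)) (Σcond-at-j j a)) ⟩
            μ S xS * (joint j xS a ÷₀ seedMarg j xS)
          ≡⟨ cong (λ z → μ S xS * (joint j xS a ÷₀ z)) (seedMarg≡μS j xS xS∶S) ⟩
            μ S xS * (joint j xS a ÷₀ μ S xS)
          ≡⟨ *-÷₀-cancel (μ S xS) (joint j xS a) (μS≡0⇒joint≡0 j j∉S a) ⟩
            joint j xS a ∎
          where open ≡-Reasoning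

      μU-slice-mass : Σ[ asgs k U ] (λ z → mask (does (restr S z ≟PA xS)) (μ U z)) ≡ μ S xS
      μU-slice-mass = trans (sym (marg-as-Σ U S (μ U) xS)) (marg-μ U S ∣S∪T∣≤m ∣S∣≤m (S∪X∩S≡S T) xS xS∶S)

      μU-slice-joint : ∀ j → lookup S j ≡ false → lookup T j ≡ true → ∀ a →
                       Σ[ asgs k U ] (λ z → mask (does (restr S z ≟PA xS)) (mask (does (lookup z j ≟M just a)) (μ U z)))
                         ≡ joint j xS a
      μU-slice-joint j j∉S j∈T a =
        trans (Σ-cong (asgs k U) slice∧value≡extension)
          (trans (sym (marg-as-Σ U (S ∪ ⁅ j ⁆) (μ U) (xS [ j ]≔ just a)))
                 (marg-μ U (S ∪ ⁅ j ⁆) ∣S∪T∣≤m (∣S∪j∣≤m j) U∩[S∪j]≡S∪j (xS [ j ]≔ just a)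
                         (HasDomain-extend S xS j a xS∶S j∉S)))
        where
        U∩[S∪j]≡S∪j : U ∩ (S ∪ ⁅ j ⁆) ≡ S ∪ ⁅ j ⁆
        U∩[S∪j]≡S∪j = trans (sym (SubP.∪-distribˡ-∩ S T ⁅ j ⁆)) (cong (S ∪_) (p∩⁅x⁆≡⁅x⁆ T j j∈T))
        slice∧value≡extension : ∀ z → mask (does (restr S z ≟PA xS)) (mask (does (lookup z j ≟M just a)) (μ U z))
                                      ≡ mask (does (restr (S ∪ ⁅ j ⁆) z ≟PA (xS [ j ]≔ just a))) (μ U z)
        slice∧value≡extension z =
          trans (sym (mask-∧ (does (restr S z ≟PA xS)) (does (lookup z j ≟M just a)) (μ U z)))
            (cong (λ b → mask b (μ U z))
              (sym (trans (cong (λ y → does (y ≟PA (xS [ j ]≔ just a))) (restr-∪⁅⁆ S z j j∉S))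
                          (≟PA-[]≔ (restr S z) xS j (lookup z j) (just a)
                                   (trans (lookup-restr S z j) (cong (λ b → if b then lookup z j else nothing) j∉S))
                                   (HasDomain-∉ S xS j xS∶S j∉S)))))

      private
        c : PA n k
        c = modeAssignment xS

      lookup-mode-∉ : ∀ j → lookup S j ≡ false → lookup c j ≡ just (mode xS j)
      lookup-mode-∉ j j∉S = trans (VecP.lookup∘tabulate _ j) (cong (λ b → if b then lookup xS j else just (mode xS j)) j∉S)

      slice-agrees-with-mode : ∀ ω → restr S ω ≡ xS → ∀ j → lookup S j ≡ true → lookup ω j ≡ lookup c j
      slice-agrees-with-mode ω restr≡ j j∈S = begin
          lookup ω j                                           ≡⟨ cong (λ b → if b then lookup ω j else nothing) (sym j∈S) ⟩
          (if lookup S j then lookup ω j else nothing)         ≡⟨ sym (lookup-restr S ω j) ⟩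
          lookup (restr S ω) j                                 ≡⟨ cong (λ y → lookup y j) restr≡ ⟩
          lookup xS j                                          ≡⟨ cong (λ b → if b then lookup xS j else just (mode xS j)) (sym j∈S) ⟩
          (if lookup S j then lookup xS j else just (mode xS j)) ≡⟨ sym (VecP.lookup∘tabulate _ j) ⟩
          lookup c j                                           ∎
        where open ≡-Reasoning

      off-mode≤deficit : ∀ (xs : List (PA n k)) (w : PA n k → ℚ) → (∀ ω → ω ∈ xs → 0ℚ ≤ w ω) →
                         slice-mass xs w (restr S) xS (λ _ → true) ≡ μ S xS →
                         (∀ j → lookup (T ─ S) j ≡ true →
                            slice-mass xs w (restr S) xS (λ ω → does (lookup ω j ≟M just (mode xS j))) ≡ joint j xS (mode xS j)) →
                         slice-mass xs w (restr S) xS (λ ω → not (does (restr T ω ≟PA restr T c))) ≤ deficit xS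
      off-mode≤deficit xs w 0≤w mass≡μS mass-at-mode≡joint = begin
          slice-mass xs w (restr S) xS (λ ω → not (does (restr T ω ≟PA restr T c)))
        ≤⟨ Σ-mono-∈ xs (λ ω ω∈ → mask-does-mono (restr S ω ≟PA xS) (λ restr≡ →
             restr-≢-union-bound T S ω c (0≤w ω ω∈) (slice-agrees-with-mode ω restr≡))) ⟩
          Σ[ xs ] (λ ω → mask (s ω) (Σ[∈ T ─ S ] (λ j → off-at j ω)))
        ≡⟨ trans (Σ-cong xs (λ ω → mask-Σ∈ (T ─ S) (s ω) (λ j → off-at j ω)))
                 (Σ-Σ∈ (T ─ S) xs (λ ω j → mask (s ω) (off-at j ω))) ⟩
          Σ[∈ T ─ S ] (λ j → Σ[ xs ] (λ ω → mask (s ω) (off-at j ω)))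
        ≤⟨ Σ∈-mono (T ─ S) (λ j j∈T─S → ℚP.≤-reflexive (off-at-j≡ j j∈T─S)) ⟩
          deficit xS ∎
        where
        open ℚP.≤-Reasoning
        s : PA n k → Bool
        s ω = does (restr S ω ≟PA xS)
        off-at : Fin n → PA n k → ℚ
        off-at j ω = mask (not (does (lookup ω j ≟M lookup c j))) (w ω)
        off-at-j≡ : ∀ j → lookup (T ─ S) j ≡ true → Σ[ xs ] (λ ω → mask (s ω) (off-at j ω)) ≡ μ S xS - joint j xS (mode xS j)
        off-at-j≡ j j∈T─S rewrite lookup-mode-∉ j (proj₂ (lookup-─ T S j j∈T─S)) =
          trans (Σ-cong xs (λ ω → trans (cong (mask (s ω)) (mask-not (does (lookup ω j ≟M just (mode xS j))) (w ω)))
                                        (mask-distrib-- (s ω) (w ω) _)))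
                (trans (Σ-- xs (λ ω → mask (s ω) (w ω)) _) (cong₂ _-_ mass≡μS (mass-at-mode≡joint j j∈T─S)))

      slice-gap≤deficit : ∀ A → ℚ.∣ slice-mass (asgs k U) (μ U) (restr S) xS (A ∘ restr T)
                                    - slice-mass Ω ν (restr S) xS (A ∘ restr T) ∣ ≤ deficit xS
      slice-gap≤deficit A = ∣p-q∣≤window (A (restr T c))
        (slice-mass∈Window (asgs k U) (μ U) (restr S) xS μU-nonneg (restr T) (restr T c) A
          (μU-slice-mass)
          (off-mode≤deficit (asgs k U) (μ U) μU-nonneg (μU-slice-mass)
            (λ j j∈T─S → let j∈T , j∉S = lookup-─ T S j j∈T─S in μU-slice-joint j j∉S j∈T (mode xS j))))
        (slice-mass∈Window Ω ν (restr S) xS ν-nonneg (restr T) (restr T c) A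
          (ν-slice-mass)
          (off-mode≤deficit Ω ν ν-nonneg (ν-slice-mass)
            (λ j j∈T─S → ν-slice-joint j (proj₂ (lookup-─ T S j j∈T─S)) (mode xS j))))

    -- The pieces of condVar (Defs): condVar L j S unfolds to Σ_{xS} μ S xS * (1 − Σ_a condDist j xS a ²).
    numer : Fin n → PA n k → Fin k → ℚ
    numer j xS a =
      Σ[ filter (λ z → lookup z j ≟M just a) (filter (λ z → restr S z ≟PA xS) (asgs k (S ∪ ⁅ j ⁆))) ] μ (S ∪ ⁅ j ⁆)

    condDist : Fin n → PA n k → Fin k → ℚ
    condDist j xS a = numer j xS a ÷₀ seedMarg j xS

    module _ (j : Fin n) (xS : PA n k) where

      private
        μj : PA n k → ℚ
        μj = μ (S ∪ ⁅ j ⁆)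
        Ωj : List (PA n k)
        Ωj = asgs k (S ∪ ⁅ j ⁆)
        on-slice : PA n k → Bool
        on-slice z = does (restr S z ≟PA xS)
        at : Fin k → PA n k → Bool
        at a z = does (lookup z j ≟M just a)

      numer-as-Σ : ∀ a → numer j xS a ≡ Σ[ Ωj ] (λ z → mask (on-slice z) (mask (at a z) (μj z)))
      numer-as-Σ a = trans (Σ-filter (λ z → lookup z j ≟M just a) (filter (λ z → restr S z ≟PA xS) Ωj) μj)
                           (Σ-filter (λ z → restr S z ≟PA xS) Ωj (λ z → mask (at a z) (μj z)))

      numer-nonneg : ∀ a → 0ℚ ≤ numer j xS a
      numer-nonneg a = subst (0ℚ ≤_) (sym (numer-as-Σ a))
        (Σ-nonneg Ωj (λ z z∈ → mask-nonneg (on-slice z) (mask-nonneg (at a z) (μ-nonneg (S ∪ ⁅ j ⁆) (∣S∪j∣≤m j) z z∈))))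

      Σnumer≤seedMarg : Σ[ allFin k ] (numer j xS) ≤ seedMarg j xS
      Σnumer≤seedMarg = begin
          Σ[ allFin k ] (numer j xS)
        ≡⟨ Σ-cong (allFin k) numer-as-Σ ⟩
          Σ[ allFin k ] (λ a → Σ[ Ωj ] (λ z → mask (on-slice z) (mask (at a z) (μj z))))
        ≡⟨ Σ-swap (allFin k) Ωj (λ a z → mask (on-slice z) (mask (at a z) (μj z))) ⟩
          Σ[ Ωj ] (λ z → Σ[ allFin k ] (λ a → mask (on-slice z) (mask (at a z) (μj z))))
        ≡⟨ Σ-cong Ωj (λ z → Σ-mask (allFin k) (on-slice z) (λ a → mask (at a z) (μj z))) ⟩
          Σ[ Ωj ] (λ z → mask (on-slice z) (Σ[ allFin k ] (λ a → mask (at a z) (μj z))))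
        ≤⟨ Σ-mono-∈ Ωj (λ z z∈ → mask-mono (on-slice z) (one-value≤ (lookup z j) (μ-nonneg (S ∪ ⁅ j ⁆) (∣S∪j∣≤m j) z z∈))) ⟩
          Σ[ Ωj ] (λ z → mask (on-slice z) (μj z))
        ≡⟨ sym (marg-as-Σ (S ∪ ⁅ j ⁆) S μj xS) ⟩
          seedMarg j xS ∎
        where
        open ℚP.≤-Reasoning
        one-value≤ : ∀ (v : Maybe (Fin k)) {X} → 0ℚ ≤ X → Σ[ allFin k ] (λ a → mask (does (v ≟M just a)) X) ≤ X
        one-value≤ nothing  0≤X = subst (_≤ _) (sym (Σ-0 (allFin k))) 0≤X
        one-value≤ (just b) {X} _ = ℚP.≤-reflexive (Σ-allFin-δ b (λ _ → X))

      condDist-nonneg : ∀ a → 0ℚ ≤ condDist j xS a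
      condDist-nonneg a = ÷₀-nonneg (numer-nonneg a) (seedMarg-nonneg j xS)

      ΣcondDist≤1 : Σ[ allFin k ] (condDist j xS) ≤ 1ℚ
      ΣcondDist≤1 = subst (_≤ 1ℚ) (sym (Σ-÷₀ (allFin k) (numer j xS) (seedMarg j xS)))
                          (p≤q⇒p÷₀q≤1 (seedMarg-nonneg j xS) Σnumer≤seedMarg)

      ΣcondDist²≤1 : Σ[ allFin k ] (λ a → condDist j xS a * condDist j xS a) ≤ 1ℚ
      ΣcondDist²≤1 = ℚP.≤-trans (Σ-mono (allFin k) p²≤p) ΣcondDist≤1
        where
        p≤1 : ∀ a → condDist j xS a ≤ 1ℚ
        p≤1 a = ℚP.≤-trans (term≤Σ (allFin k) (condDist j xS) (∈-allFin a) condDist-nonneg) ΣcondDist≤1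
        p²≤p : ∀ a → condDist j xS a * condDist j xS a ≤ condDist j xS a
        p²≤p a = ℚP.≤-trans (*-monoʳ-≤-0≤ (condDist-nonneg a) (p≤1 a)) (ℚP.≤-reflexive (ℚP.*-identityˡ _))

      condDist≡joint/μS : ∀ a → HasDomain S xS → lookup S j ≡ false → condDist j xS a ≡ joint j xS a ÷₀ μ S xS
      condDist≡joint/μS a xS∶S j∉S = cong₂ _÷₀_
        (trans (numer-as-Σ a)
          (trans (Σ-asgs-extension S xS j xS∶S j∉S (λ z → mask (at a z) (μj z)))
            (trans (Σ-cong (allFin k) (λ b → cong (λ v → mask (does (v ≟M just a)) (joint j xS b)) (VecP.lookup∘updateAt j xS)))
                   (Σ-allFin-δ′ a (joint j xS)))))
        (seedMarg≡μS j xS xS∶S)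

    condVar-nonneg : ∀ j → 0ℚ ≤ condVar L j S
    condVar-nonneg j =
      Σ-nonneg (asgs k S) (λ xS xS∈ → *-nonneg (μ-nonneg S ∣S∣≤m xS xS∈) (0≤1-p (ΣcondDist²≤1 j xS)))

    deficit-term≤variance-term : ∀ j xS → HasDomain S xS → lookup S j ≡ false →
                                 μ S xS - joint j xS (mode xS j)
                                   ≤ μ S xS * (1ℚ - Σ[ allFin k ] (λ a → condDist j xS a * condDist j xS a))
    deficit-term≤variance-term j xS xS∶S j∉S =
      subst (λ Σp² → μ S xS - joint j xS (mode xS j) ≤ μ S xS * (1ℚ - Σp²))
            (Σ-cong (allFin k) (λ a → sym (cong₂ _*_ (p≡ a) (p≡ a))))
            (off-mode≤variance (joint j xS) (mode xS j) (joint-nonneg xS xS∶S j j∉S) (joint≤mode xS j)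
                               (Σjoint≡μS xS xS∶S j j∉S))
      where
      p≡ : ∀ a → condDist j xS a ≡ joint j xS a ÷₀ μ S xS
      p≡ a = condDist≡joint/μS j xS a xS∶S j∉S

    Σdeficit≤ΣcondVar : Σ[ asgs k S ] deficit ≤ Σ[ filter (_∈? T) (allFin n) ] (λ s → condVar L s S)
    Σdeficit≤ΣcondVar = begin
        Σ[ asgs k S ] deficit
      ≡⟨ Σ-Σ∈ (T ─ S) (asgs k S) (λ xS j → μ S xS - joint j xS (mode xS j)) ⟩
        Σ[∈ T ─ S ] (λ j → Σ[ asgs k S ] (λ xS → μ S xS - joint j xS (mode xS j)))
      ≤⟨ Σ∈-mono (T ─ S) (λ j j∈T─S → Σ-mono-∈ (asgs k S) (λ xS xS∈ →
           deficit-term≤variance-term j xS (∈asgs⇒HasDomain S xS∈) (proj₂ (lookup-─ T S j j∈T─S)))) ⟩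
        Σ[∈ T ─ S ] (λ j → condVar L j S)
      ≤⟨ Σ∈─≤Σ∈ T S (λ j → condVar L j S) (λ j _ → condVar-nonneg j) ⟩
        Σ[∈ T ] (λ j → condVar L j S)
      ≡⟨ sym (Σ-filter-∈ T (λ j → condVar L j S)) ⟩
        Σ[ filter (_∈? T) (allFin n) ] (λ s → condVar L s S) ∎
      where open ℚP.≤-Reasoning

open import Data.Nat using (ℕ; _+_; _≤_)
open import Data.Bool using (Bool)
open import Data.List using (filter; allFin)
open import Data.Fin.Subset using (Subset; ∣_∣)
open import Data.Fin.Subset.Properties using (_∈?_)
open import Data.Rational using (ℚ; _-_) renaming (_≤_ to _≤ℚ_; ∣_∣ to abs)
open import Relation.Binary.PropositionalEquality using (_≡_)

open Lemmas
open import Data.Rational.Properties using (module ≤-Reasoning)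
open import Relation.Binary.PropositionalEquality using (cong₂)

lemma8p1 : ∀ {n k m t : ℕ} (L : LocalDists n k m) (S : Subset n) →
           1 ≤ t → ∣ S ∣ + t ≡ m →
           ∀ (T : Subset n) → ∣ T ∣ ≤ t →
           ∀ (A : PA n k → Bool) →
           abs (Prob k T (LocalDists.μ L T) A - Prob k T (propRoundMarg L S T) A)
             ≤ℚ Σ[ filter (λ s → s ∈? T) (allFin n) ] (λ s → condVar L s S)
lemma8p1 {n} {k} {m} {t} L S 1≤t ∣S∣+t≡m T ∣T∣≤t A = begin
    abs (Prob k T (μ T) A - Prob k T (propRoundMarg L S T) A)
  ≡⟨ cong₂ (λ p q → abs (p - q)) (Prob-μT≡Σ-slices A) (Prob-ν≡Σ-slices A) ⟩
    abs (Σ[ asgs k S ] μU-mass - Σ[ asgs k S ] ν-mass)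
  ≤⟨ ∣Σ-Σ∣≤Σ∣-∣ (asgs k S) μU-mass ν-mass ⟩
    Σ[ asgs k S ] (λ xS → abs (μU-mass xS - ν-mass xS))
  ≤⟨ Σ-mono-∈ (asgs k S) (λ xS xS∈ → slice-gap≤deficit xS (∈asgs⇒HasDomain S xS∈) A) ⟩
    Σ[ asgs k S ] deficit
  ≤⟨ Σdeficit≤ΣcondVar ⟩
    Σ[ filter (λ s → s ∈? T) (allFin n) ] (λ s → condVar L s S) ∎
  where
  open ≤-Reasoning
  open LocalDists L using (μ)
  open PropagationRounding L S T (∣S∪X∣≤m S T ∣T∣≤t ∣S∣+t≡m) (∣S∪⁅j⁆∣≤m S 1≤t ∣S∣+t≡m)
                                 (value-exists L (1≤m 1≤t ∣S∣+t≡m))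
  μU-mass ν-mass : PA n k → ℚ
  μU-mass xS = slice-mass (asgs k U) (μ U) (restr S) xS (λ z → A (restr T z))
  ν-mass  xS = slice-mass Ω ν (restr S) xS (λ x → A (restr T x))
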